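{- Fix a prime $p$ and $m\in\mathbb{Z}_{\ge0}$. For $n\ge1$ let $X_n=\sum_{i=1}^nB_i$, where $B_1,B_2,\dots$ are independent Bernoulli random variables with $\mathrm{Prob}(B_i=1)=1/(p^{i-1}+1)$, and let $X_{\mathrm{Sel}_p}$ be a $\mathbb{Z}_{\ge0}$-valued random variable with $\mathrm{Prob}(X_{\mathrm{Sel}_p}=d)=c\prod_{j=1}^d\frac{p}{p^j-1}$ for all $d\ge0$, where $c=\prod_{j\ge0}(1+p^{ -j})^{ -1}$. Then: (a) $\mathbb{E}\big((p^{X_n})^m\big)=\prod_{i=1}^m\frac{p^i+1}{1+p^{ -(n-i)}}$ and $\mathbb{E}\big((p^{X_{\mathrm{Sel}_p}})^m\big)=\prod_{i=1}^m(p^i+1)$; in particular $\mathbb{E}(p^{X_{\mathrm{Sel}_p}})=p+1$. (b) $\mathrm{Prob}(X_n\text{ is even})=1/2$ for each $n>0$, and $\mathrm{Prob}(X_{\mathrm{Sel}_p}\text{ is even})=1/2$. (c) Conditioned on the event that $X_{\mathrm{Sel}_p}$ has a prescribed parity, the $m$-th moment of $p^{X_{\mathrm{Sel}_p}}$ remains $\prod_{i=1}^m(p^i+1)$. Likewise, if $m<n$, the $m$-th moment of $p^{X_n}$ conditioned on $X_n$ having a prescribed parity equals the unconditioned value in (a). -}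

module Defs where

open import Data.Bool using (Bool; true; false; if_then_else_)
open import Data.Nat as ℕ using (ℕ; zero; suc; _∸_; _≤_)
open import Data.Integer as ℤ using (ℤ; +_; -[1+_])
open import Data.Rational using (ℚ; 0ℚ; 1ℚ; _+_; _*_; _-_; _<_; ∣_∣; 1/_; ≢-nonZero)
import Data.Rational as ℚ
open import Data.Rational.Properties using (_≟_)
open import Data.List using (List; []; _∷_; map; _++_; foldr)
open import Data.Vec using (Vec; []; _∷_)
open import Data.Product using (∃-syntax)
open import Relation.Nullary using (yes; no)

fromℕ : ℕ → ℚ
fromℕ n = + n ℚ./ 1

powℚ : ℚ → ℕ → ℚ
powℚ q zero    = 1ℚ
powℚ q (suc k) = q * powℚ q k

-- total reciprocal: inv q = 1/q for q ≠ 0 (and inv 0 = 0, never used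
-- at 0 in the statement except possibly finitely many terms of a limit)
inv : ℚ → ℚ
inv q with q ≟ 0ℚ
... | yes _ = 0ℚ
... | no q≢0 = 1/_ q {{≢-nonZero q≢0}}

zpow : ℕ → ℤ → ℚ
zpow p (+ k)     = fromℕ (p ℕ.^ k)
zpow p -[1+ k ]  = inv (fromℕ (p ℕ.^ suc k))

prod1 : ℕ → (ℕ → ℚ) → ℚ
prod1 zero    f = 1ℚ
prod1 (suc m) f = prod1 m f * f (suc m)

prod0 : ℕ → (ℕ → ℚ) → ℚ
prod0 zero    f = f zero
prod0 (suc N) f = prod0 N f * f (suc N)

sum0 : ℕ → (ℕ → ℚ) → ℚ
sum0 zero    f = f zero
sum0 (suc N) f = sum0 N f + f (suc N)

ConvergesTo : (ℕ → ℚ) → ℚ → Set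
ConvergesTo s L = ∀ (ε : ℚ) → 0ℚ < ε → ∃[ N ] (∀ n → N ≤ n → ∣ s n - L ∣ < ε)

isEven : ℕ → Bool
isEven zero          = true
isEven (suc zero)    = false
isEven (suc (suc n)) = isEven n

hasParity : Bool → ℕ → ℚ
hasParity true  d = if isEven d then 1ℚ else 0ℚ
hasParity false d = if isEven d then 0ℚ else 1ℚ

-- X_n = B_1 + ... + B_n, B_i independent Bernoulli with
-- Prob(B_i = 1) = 1/(p^{i-1}+1).  Sample space: {0,1}^n = Vec Bool n,
-- with the product measure.

bernoulliP : ℕ → ℕ → ℚ
bernoulliP p i = inv (fromℕ (p ℕ.^ (i ∸ 1)) + 1ℚ)

allOutcomes : (n : ℕ) → List (Vec Bool n)
allOutcomes zero    = [] ∷ []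
allOutcomes (suc n) = map (true ∷_) (allOutcomes n) ++ map (false ∷_) (allOutcomes n)

probFrom : ℕ → ℕ → ∀ {k} → Vec Bool k → ℚ
probFrom p i []             = 1ℚ
probFrom p i (true  ∷ bs) = bernoulliP p i * probFrom p (suc i) bs
probFrom p i (false ∷ bs) = (1ℚ - bernoulliP p i) * probFrom p (suc i) bs

count : ∀ {k} → Vec Bool k → ℕ
count []            = 0
count (true  ∷ bs) = suc (count bs)
count (false ∷ bs) = count bs

expectXn : (p n : ℕ) → (ℕ → ℚ) → ℚ
expectXn p n f = foldr (λ bs acc → probFrom p 1 bs * f (count bs) + acc) 0ℚ (allOutcomes n)

condExpectXn : (p n : ℕ) → (ℕ → ℚ) → Bool → ℚ
condExpectXn p n f b =
  expectXn p n (λ d → hasParity b d * f d) * inv (expectXn p n (hasParity b))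

selWeight : ℕ → ℕ → ℚ
selWeight p d = prod1 d (λ j → fromℕ p * inv (fromℕ (p ℕ.^ j) - 1ℚ))

cPartial : ℕ → ℕ → ℚ
cPartial p N = prod0 N (λ j → inv (1ℚ + zpow p (ℤ.- (+ j))))

-- N-th partial approximation of E( f (X_Sel) ) = c · ∑_{d≥0} (∏ ...) f d
selExpectPartial : ℕ → (ℕ → ℚ) → ℕ → ℚ
selExpectPartial p f N = cPartial p N * sum0 N (λ d → selWeight p d * f d)

selCondExpectPartial : ℕ → (ℕ → ℚ) → Bool → ℕ → ℚ
selCondExpectPartial p f b N =
  selExpectPartial p (λ d → hasParity b d * f d) N
    * inv (selExpectPartial p (hasParity b) N)

-- Both variables are handled through generating functions.  For X_n,
-- E(r^{X_n}) = ∏_{t<n} (p^t + r)/(p^t + 1); at r = p^m this product telescopes to the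
-- stated one, and at r = -p^m its factor t = m vanishes once m < n.  Writing the parity
-- indicator as ½ ± ½(-1)^d, the parity-weighted moments of p^{X_n} are therefore exactly
-- half of the plain ones.
-- For X_Sel the weights u_d satisfy u_{d+1} (p^{d+1} - 1) = p u_d, so the truncated series
-- F_N(z) = ∑_{d≤N} u_d z^d obeys F_N(pz) = (1 + pz) F_N(z) up to the boundary term
-- pz u_N z^N.  Iterating from z = 1 and from z = -1/p gives F_N(p^m) ≈ ∏_{i≤m} (1 + p^i) F_N(1)
-- and F_N(-p^m) ≈ 0, the latter being what makes both parities equally likely; iterating
-- at z = p^{-k} gives F_N(1) ≈ ∏_{j≤N} (1 + p^{-j}), the reciprocal of the normalising
-- partial product.  Every error is a multiple of u_N p^{mN}, which eventually halves from
-- one N to the next, so the approximate identities become limits.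

module Submission where

open import Defs

module _ where

  open import Data.Empty using (⊥-elim)
  open import Data.Integer as ℤ using (ℤ; +_; -[1+_])
  import Data.Integer.Properties as ℤ
  open import Data.List using (List; []; _∷_; map; _++_; foldr)
  open import Data.Nat as ℕ using (ℕ; zero; suc; _∸_; z≤n; s≤s)
  import Data.Nat.Coprimality as Coprime
  import Data.Nat.Properties as ℕ
  open import Data.Bool using (Bool; true; false)
  open import Data.Product using (∃-syntax; _,_; _×_; map₂; proj₁; proj₂)
  open import Data.Rational using (ℚ; 0ℚ; 1ℚ; ½; _+_; _*_; _-_; -_; _<_; _≤_; ∣_∣; mkℚ; *≤*; *<*; positive; nonNegative; ≢-nonZero)
  open import Data.Rational.Properties
  open import Data.Sum using (inj₁; inj₂)
  open import Data.Vec using (Vec; []; _∷_)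
  open import Level using (0ℓ)
  open import Relation.Binary.PropositionalEquality
  open import Relation.Nullary using (yes; no)
  open import Relation.Nullary.Decidable using (dec⇒maybe)
  open import Tactic.RingSolver using (solve-∀)
  import Tactic.RingSolver.Core.AlmostCommutativeRing as ACR

  ℚ-ring : ACR.AlmostCommutativeRing 0ℓ 0ℓ
  ℚ-ring = ACR.fromCommutativeRing +-*-commutativeRing (λ x → dec⇒maybe (0ℚ ≟ x))

  fromℕ≡mkℚ : ∀ a → fromℕ a ≡ mkℚ (+ a) 0 (Coprime.sym (Coprime.1-coprimeTo a))
  fromℕ≡mkℚ a = normalize-coprime _

  fromℕ-+ : ∀ a b → fromℕ (a ℕ.+ b) ≡ fromℕ a + fromℕ b
  fromℕ-+ a b rewrite fromℕ≡mkℚ a | fromℕ≡mkℚ b | ℤ.*-identityʳ (+ a) | ℤ.*-identityʳ (+ b) = refl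

  fromℕ-* : ∀ a b → fromℕ (a ℕ.* b) ≡ fromℕ a * fromℕ b
  fromℕ-* a b = sym (trans (cong₂ _*_ (fromℕ≡mkℚ a) (fromℕ≡mkℚ b)) (cong (Data.Rational._/ 1) (sym (ℤ.pos-* a b))))

  fromℕ-mono-≤ : ∀ {a b} → a ℕ.≤ b → fromℕ a ≤ fromℕ b
  fromℕ-mono-≤ {a} {b} a≤b rewrite fromℕ≡mkℚ a | fromℕ≡mkℚ b = *≤* (ℤ.*-monoʳ-≤-nonNeg (+ 1) (ℤ.+≤+ a≤b))

  0≤fromℕ : ∀ a → 0ℚ ≤ fromℕ a
  0≤fromℕ a = fromℕ-mono-≤ {0} {a} z≤n

  0<1 : 0ℚ < 1ℚ
  0<1 = positive⁻¹ 1ℚ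

  0≤½ : 0ℚ ≤ ½
  0≤½ = <⇒≤ (positive⁻¹ ½)

  *-pres-0≤ : ∀ {a b} → 0ℚ ≤ a → 0ℚ ≤ b → 0ℚ ≤ a * b
  *-pres-0≤ {a} {b} 0≤a 0≤b = nonNegative⁻¹ _ {{nonNeg*nonNeg⇒nonNeg a {{nonNegative 0≤a}} b {{nonNegative 0≤b}}}}

  +-pres-0≤ : ∀ {a b} → 0ℚ ≤ a → 0ℚ ≤ b → 0ℚ ≤ a + b
  +-pres-0≤ = +-mono-≤

  *-monoˡ-≤-0≤ : ∀ {a b} c → 0ℚ ≤ c → a ≤ b → c * a ≤ c * b
  *-monoˡ-≤-0≤ c 0≤c = *-monoˡ-≤-nonNeg c {{nonNegative 0≤c}}

  *-monoʳ-≤-0≤ : ∀ {a b} c → 0ℚ ≤ c → a ≤ b → a * c ≤ b * c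
  *-monoʳ-≤-0≤ c 0≤c = *-monoʳ-≤-nonNeg c {{nonNegative 0≤c}}

  *-mono-≤-0≤ : ∀ {a b c d} → 0ℚ ≤ a → 0ℚ ≤ c → a ≤ b → c ≤ d → a * c ≤ b * d
  *-mono-≤-0≤ {a} {b} {c} {d} 0≤a 0≤c a≤b c≤d =
    ≤-trans (*-monoˡ-≤-0≤ a 0≤a c≤d) (*-monoʳ-≤-0≤ d (≤-trans 0≤c c≤d) a≤b)

  ∣c*x∣≤c*b : ∀ {c x b} → 0ℚ ≤ c → ∣ x ∣ ≤ b → ∣ c * x ∣ ≤ c * b
  ∣c*x∣≤c*b {c} {x} 0≤c ∣x∣≤b = begin
    ∣ c * x ∣     ≡⟨ ∣p*q∣≡∣p∣*∣q∣ c x ⟩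
    ∣ c ∣ * ∣ x ∣ ≡⟨ cong (_* ∣ x ∣) (0≤p⇒∣p∣≡p 0≤c) ⟩
    c * ∣ x ∣     ≤⟨ *-monoˡ-≤-0≤ c 0≤c ∣x∣≤b ⟩
    c * _         ∎
    where open ≤-Reasoning

  p≤∣p∣ : ∀ x → x ≤ ∣ x ∣
  p≤∣p∣ x with ≤-total 0ℚ x
  ... | inj₁ 0≤x = ≤-reflexive (sym (0≤p⇒∣p∣≡p 0≤x))
  ... | inj₂ x≤0 = ≤-trans x≤0 (0≤∣p∣ x)

  0<⇒≢0 : ∀ {a} → 0ℚ < a → a ≢ 0ℚ
  0<⇒≢0 0<a a≡0 = <-irrefl (sym a≡0) 0<a

  inv-inverseˡ : ∀ {a} → a ≢ 0ℚ → inv a * a ≡ 1ℚ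
  inv-inverseˡ {a} a≢0 with a ≟ 0ℚ
  ... | yes a≡0 = ⊥-elim (a≢0 a≡0)
  ... | no a≢0′ = *-inverseˡ a {{≢-nonZero a≢0′}}

  inv-inverseʳ : ∀ {a} → a ≢ 0ℚ → a * inv a ≡ 1ℚ
  inv-inverseʳ {a} a≢0 = trans (*-comm a (inv a)) (inv-inverseˡ a≢0)

  *≡1⇒inv≡ : ∀ {a b} → a * b ≡ 1ℚ → inv a ≡ b
  *≡1⇒inv≡ {a} {b} ab≡1 = begin
    inv a             ≡⟨ sym (*-identityʳ (inv a)) ⟩
    inv a * 1ℚ        ≡⟨ cong (inv a *_) (sym ab≡1) ⟩
    inv a * (a * b)   ≡⟨ sym (*-assoc (inv a) a b) ⟩
    inv a * a * b     ≡⟨ cong (_* b) (inv-inverseˡ a≢0) ⟩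
    1ℚ * b            ≡⟨ *-identityˡ b ⟩
    b                 ∎
    where
    open ≡-Reasoning
    a≢0 : a ≢ 0ℚ
    a≢0 a≡0 = 0<⇒≢0 0<1 (trans (sym ab≡1) (trans (cong (_* b) a≡0) (*-zeroˡ b)))

  0<inv : ∀ {a} → 0ℚ < a → 0ℚ < inv a
  0<inv {a} 0<a with a ≟ 0ℚ
  ... | yes a≡0 = ⊥-elim (0<⇒≢0 0<a a≡0)
  ... | no _    = positive⁻¹ _ {{1/pos⇒pos a {{positive 0<a}}}}

  0≤inv : ∀ {a} → 0ℚ < a → 0ℚ ≤ inv a
  0≤inv 0<a = <⇒≤ (0<inv 0<a)

  inv≤1 : ∀ {a} → 1ℚ ≤ a → inv a ≤ 1ℚ
  inv≤1 {a} 1≤a = *-cancelˡ-≤-pos a {{positive 0<a}}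
      (≤-trans (≤-reflexive (inv-inverseʳ (0<⇒≢0 0<a))) (≤-trans 1≤a (≤-reflexive (sym (*-identityʳ a)))))
    where
    0<a : 0ℚ < a
    0<a = <-≤-trans 0<1 1≤a

  x*inv≤½ : ∀ {x d} → 0ℚ < d → fromℕ 2 * x ≤ d → x * inv d ≤ ½
  x*inv≤½ {x} {d} 0<d 2x≤d = begin
    x * inv d                   ≡⟨ halve x (inv d) ⟩
    ½ * (fromℕ 2 * x) * inv d   ≤⟨ *-monoʳ-≤-0≤ (inv d) (0≤inv 0<d) (*-monoˡ-≤-0≤ ½ 0≤½ 2x≤d) ⟩
    ½ * d * inv d               ≡⟨ trans (*-assoc ½ d (inv d)) (trans (cong (½ *_) (inv-inverseʳ (0<⇒≢0 0<d))) (*-identityʳ ½)) ⟩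
    ½                           ∎
    where
    open ≤-Reasoning
    halve : ∀ x i → x * i ≡ ½ * (fromℕ 2 * x) * i
    halve = solve-∀ ℚ-ring

  +-cancelʳ-≤ : ∀ {a b} c → a + c ≤ b + c → a ≤ b
  +-cancelʳ-≤ {a} {b} c a+c≤b+c = subst₂ _≤_ (cancel a c) (cancel b c) (+-monoˡ-≤ (- c) a+c≤b+c)
    where
    cancel : ∀ a c → a + c + - c ≡ a
    cancel = solve-∀ ℚ-ring

  powℚ-* : ∀ x y n → powℚ (x * y) n ≡ powℚ x n * powℚ y n
  powℚ-* x y zero    = refl
  powℚ-* x y (suc n) rewrite powℚ-* x y n = interchange x y (powℚ x n) (powℚ y n)
    where
    interchange : ∀ x y a b → x * y * (a * b) ≡ x * a * (y * b)
    interchange = solve-∀ ℚ-ring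

  powℚ-1 : ∀ n → powℚ 1ℚ n ≡ 1ℚ
  powℚ-1 zero    = refl
  powℚ-1 (suc n) rewrite powℚ-1 n = refl

  powℚ-fromℕ : ∀ a n → powℚ (fromℕ a) n ≡ fromℕ (a ℕ.^ n)
  powℚ-fromℕ a zero    = refl
  powℚ-fromℕ a (suc n) rewrite powℚ-fromℕ a n = sym (fromℕ-* a (a ℕ.^ n))

  0≤powℚ : ∀ {x} n → 0ℚ ≤ x → 0ℚ ≤ powℚ x n
  0≤powℚ zero    0≤x = <⇒≤ 0<1
  0≤powℚ (suc n) 0≤x = *-pres-0≤ 0≤x (0≤powℚ n 0≤x)

  powℚ≤1 : ∀ {x} n → 0ℚ ≤ x → x ≤ 1ℚ → powℚ x n ≤ 1ℚ
  powℚ≤1 zero    0≤x x≤1 = ≤-refl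
  powℚ≤1 (suc n) 0≤x x≤1 = *-mono-≤-0≤ 0≤x (0≤powℚ n 0≤x) x≤1 (powℚ≤1 n 0≤x x≤1)

  ∣powℚ∣ : ∀ x n → ∣ powℚ x n ∣ ≡ powℚ ∣ x ∣ n
  ∣powℚ∣ x zero    = refl
  ∣powℚ∣ x (suc n) rewrite ∣p*q∣≡∣p∣*∣q∣ x (powℚ x n) | ∣powℚ∣ x n = refl

  ∣-x∣≡x : ∀ {x} → 0ℚ ≤ x → ∣ - x ∣ ≡ x
  ∣-x∣≡x {x} 0≤x = trans (∣-p∣≡∣p∣ x) (0≤p⇒∣p∣≡p 0≤x)

  ∣powℚ-neg∣ : ∀ {x} n → 0ℚ ≤ x → ∣ powℚ (- x) n ∣ ≡ powℚ x n
  ∣powℚ-neg∣ {x} n 0≤x = trans (∣powℚ∣ (- x) n) (cong (λ y → powℚ y n) (∣-x∣≡x 0≤x))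

  powℚ-neg : ∀ x n → powℚ (- x) n ≡ powℚ (- 1ℚ) n * powℚ x n
  powℚ-neg x n = trans (cong (λ y → powℚ y n) (neg≡-1* x)) (powℚ-* (- 1ℚ) x n)
    where
    neg≡-1* : ∀ x → - x ≡ - 1ℚ * x
    neg≡-1* = solve-∀ ℚ-ring

  sign : Bool → ℚ
  sign true  = ½
  sign false = - ½

  ∣sign∣ : ∀ b → ∣ sign b ∣ ≡ ½
  ∣sign∣ true  = refl
  ∣sign∣ false = refl

  neg-1*neg-1*s≡s : ∀ s → - 1ℚ * (- 1ℚ * s) ≡ s
  neg-1*neg-1*s≡s = solve-∀ ℚ-ring

  hasParity≡½+sign : ∀ b d → hasParity b d ≡ ½ + sign b * powℚ (- 1ℚ) d
  hasParity≡½+sign true  zero          = refl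
  hasParity≡½+sign false zero          = refl
  hasParity≡½+sign true  (suc zero)    = refl
  hasParity≡½+sign false (suc zero)    = refl
  hasParity≡½+sign true  (suc (suc d)) = trans (hasParity≡½+sign true d) (cong (λ s → ½ + ½ * s) (sym (neg-1*neg-1*s≡s (powℚ (- 1ℚ) d))))
  hasParity≡½+sign false (suc (suc d)) = trans (hasParity≡½+sign false d) (cong (λ s → ½ + - ½ * s) (sym (neg-1*neg-1*s≡s (powℚ (- 1ℚ) d))))

  archimedean : ∀ x → ∃[ k ] x < fromℕ k
  archimedean x@(mkℚ (+ a) d _) = suc a , subst (x <_) (sym (fromℕ≡mkℚ (suc a)))
    (*<* (subst (ℤ._< + suc a ℤ.* + suc d) (sym (ℤ.*-identityʳ (+ a))) (ℤ.+<+ (ℕ.m≤m*n (suc a) (suc d)))))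
  archimedean x@(mkℚ -[1+ a ] d _) = 0 , subst (x <_) (sym (fromℕ≡mkℚ 0)) (*<* ℤ.-<+)

  Null : (ℕ → ℚ) → Set
  Null b = ∀ ε → 0ℚ < ε → ∃[ N ] (∀ n → N ℕ.≤ n → b n < ε)

  0<½* : ∀ {ε} → 0ℚ < ε → 0ℚ < ½ * ε
  0<½* {ε} 0<ε = subst (_< ½ * ε) (*-zeroʳ ½) (*-monoʳ-<-pos ½ 0<ε)

  Null-+ : ∀ {a b} → Null a → Null b → Null (λ n → a n + b n)
  Null-+ {a} {b} a→0 b→0 ε 0<ε with a→0 (½ * ε) (0<½* 0<ε) | b→0 (½ * ε) (0<½* 0<ε)
  ... | N₁ , a<ε/2 | N₂ , b<ε/2 = N₁ ℕ.+ N₂ , λ n N≤n →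
    subst (a n + b n <_) (halves ε)
      (+-mono-< (a<ε/2 n (ℕ.≤-trans (ℕ.m≤m+n N₁ N₂) N≤n)) (b<ε/2 n (ℕ.≤-trans (ℕ.m≤n+m N₂ N₁) N≤n)))
    where
    halves : ∀ e → ½ * e + ½ * e ≡ e
    halves = solve-∀ ℚ-ring

  Null-scale : ∀ {b} c → 0ℚ ≤ c → Null b → Null (λ n → c * b n)
  Null-scale {b} c 0≤c b→0 ε 0<ε =
    map₂ (λ b<δ n N≤n → ≤-<-trans (*-monoˡ-≤-0≤ c 0≤c (<⇒≤ (b<δ n N≤n))) cδ<ε) (b→0 δ 0<δ)
    where
    0<c+1 : 0ℚ < c + 1ℚ
    0<c+1 = subst (_< c + 1ℚ) (+-identityʳ 0ℚ) (+-mono-≤-< 0≤c 0<1)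
    δ : ℚ
    δ = inv (c + 1ℚ) * ε
    0<δ : 0ℚ < δ
    0<δ = subst (_< δ) (*-zeroʳ (inv (c + 1ℚ))) (*-monoʳ-<-pos (inv (c + 1ℚ)) {{positive (0<inv 0<c+1)}} 0<ε)
    cδ<ε : c * δ < ε
    cδ<ε = begin-strict
      c * δ                         <⟨ *-monoˡ-<-pos δ {{positive 0<δ}} (subst (_< c + 1ℚ) (+-identityʳ c) (+-monoʳ-< c 0<1)) ⟩
      (c + 1ℚ) * δ                  ≡⟨ sym (*-assoc (c + 1ℚ) (inv (c + 1ℚ)) ε) ⟩
      (c + 1ℚ) * inv (c + 1ℚ) * ε   ≡⟨ cong (_* ε) (inv-inverseʳ (0<⇒≢0 0<c+1)) ⟩
      1ℚ * ε                        ≡⟨ *-identityˡ ε ⟩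
      ε                             ∎
      where open ≤-Reasoning

  ½*[2+k]≤1+k : ∀ k → ½ * fromℕ (suc (suc k)) ≤ fromℕ (suc k)
  ½*[2+k]≤1+k k = begin
    ½ * fromℕ (suc (suc k))           ≤⟨ *-monoˡ-≤-0≤ ½ 0≤½ (fromℕ-mono-≤ 2+k≤2*[1+k]) ⟩
    ½ * fromℕ (2 ℕ.* suc k)           ≡⟨ cong (½ *_) (fromℕ-* 2 (suc k)) ⟩
    ½ * (fromℕ 2 * fromℕ (suc k))     ≡⟨ ½*[2*y]≡y (fromℕ (suc k)) ⟩
    fromℕ (suc k)                     ∎
    where
    open ≤-Reasoning
    2+k≤2*[1+k] : suc (suc k) ℕ.≤ 2 ℕ.* suc k
    2+k≤2*[1+k] = s≤s (ℕ.≤-trans (ℕ.m≤n+m (suc k) k) (ℕ.≤-reflexive (cong (k ℕ.+_) (sym (ℕ.+-identityʳ (suc k))))))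
    ½*[2*y]≡y : ∀ y → ½ * (fromℕ 2 * y) ≡ y
    ½*[2*y]≡y = solve-∀ ℚ-ring

  module _ {x : ℕ → ℚ} (0≤x : ∀ n → 0ℚ ≤ x n) (N₀ : ℕ)
           (halving : ∀ n → N₀ ℕ.≤ n → x (suc n) ≤ ½ * x n) where

    x[N₀+k]*[1+k]≤x[N₀] : ∀ k → x (N₀ ℕ.+ k) * fromℕ (suc k) ≤ x N₀
    x[N₀+k]*[1+k]≤x[N₀] zero rewrite ℕ.+-identityʳ N₀ = ≤-reflexive (*-identityʳ (x N₀))
    x[N₀+k]*[1+k]≤x[N₀] (suc k) rewrite ℕ.+-suc N₀ k = begin
      x (suc (N₀ ℕ.+ k)) * fromℕ (suc (suc k))   ≤⟨ *-monoʳ-≤-0≤ _ (0≤fromℕ (suc (suc k))) (halving (N₀ ℕ.+ k) (ℕ.m≤m+n N₀ k)) ⟩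
      ½ * x (N₀ ℕ.+ k) * fromℕ (suc (suc k))     ≡⟨ reassoc (x (N₀ ℕ.+ k)) (fromℕ (suc (suc k))) ⟩
      x (N₀ ℕ.+ k) * (½ * fromℕ (suc (suc k)))   ≤⟨ *-monoˡ-≤-0≤ _ (0≤x (N₀ ℕ.+ k)) (½*[2+k]≤1+k k) ⟩
      x (N₀ ℕ.+ k) * fromℕ (suc k)               ≤⟨ x[N₀+k]*[1+k]≤x[N₀] k ⟩
      x N₀                                       ∎
      where
      open ≤-Reasoning
      reassoc : ∀ a b → ½ * a * b ≡ a * (½ * b)
      reassoc = solve-∀ ℚ-ring

    Null-halving : Null x
    Null-halving ε 0<ε with archimedean (x N₀ * inv ε)
    ... | k , x[N₀]/ε<k = N₀ ℕ.+ k , x<ε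
      where
      x[N₀]<ε*k : x N₀ < ε * fromℕ k
      x[N₀]<ε*k = subst₂ _<_
        (trans (*-assoc (x N₀) (inv ε) ε) (trans (cong (x N₀ *_) (inv-inverseˡ (0<⇒≢0 0<ε))) (*-identityʳ (x N₀))))
        (*-comm (fromℕ k) ε)
        (*-monoˡ-<-pos ε {{positive 0<ε}} x[N₀]/ε<k)
      x<ε : ∀ n → N₀ ℕ.+ k ℕ.≤ n → x n < ε
      x<ε n N₀+k≤n = *-cancelʳ-<-nonNeg (fromℕ (suc j)) {{nonNegative (0≤fromℕ (suc j))}} (begin-strict
          x n * fromℕ (suc j)            ≡⟨ cong (λ i → x i * fromℕ (suc j)) (sym N₀+j≡n) ⟩
          x (N₀ ℕ.+ j) * fromℕ (suc j)   ≤⟨ x[N₀+k]*[1+k]≤x[N₀] j ⟩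
          x N₀                           <⟨ x[N₀]<ε*k ⟩
          ε * fromℕ k                    ≤⟨ *-monoˡ-≤-0≤ ε (<⇒≤ 0<ε) (fromℕ-mono-≤ k≤1+j) ⟩
          ε * fromℕ (suc j)              ∎)
        where
        open ≤-Reasoning
        j : ℕ
        j = n ∸ N₀
        N₀+j≡n : N₀ ℕ.+ j ≡ n
        N₀+j≡n = ℕ.m+[n∸m]≡n (ℕ.≤-trans (ℕ.m≤m+n N₀ k) N₀+k≤n)
        k≤1+j : k ℕ.≤ suc j
        k≤1+j = ℕ.≤-trans (ℕ.+-cancelˡ-≤ N₀ k j (subst (N₀ ℕ.+ k ℕ.≤_) (sym N₀+j≡n) N₀+k≤n)) (ℕ.n≤1+n j)

  converges-by-null : ∀ {s L b} → Null b → ∀ N₀ → (∀ n → N₀ ℕ.≤ n → ∣ s n - L ∣ ≤ b n) → ConvergesTo s L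
  converges-by-null b→0 N₀ ∣s-L∣≤b ε 0<ε with b→0 ε 0<ε
  ... | N , b<ε = N₀ ℕ.+ N , λ n N₀+N≤n →
    ≤-<-trans (∣s-L∣≤b n (ℕ.≤-trans (ℕ.m≤m+n N₀ N) N₀+N≤n)) (b<ε n (ℕ.≤-trans (ℕ.m≤n+m N N₀) N₀+N≤n))

  ConvergesTo-cong : ∀ {s t L L′} → (∀ n → s n ≡ t n) → L ≡ L′ → ConvergesTo s L → ConvergesTo t L′
  ConvergesTo-cong s≡t refl s→L ε 0<ε = map₂ (λ close n N≤n → subst (λ y → ∣ y - _ ∣ < ε) (s≡t n) (close n N≤n)) (s→L ε 0<ε)

  ¼ : ℚ
  ¼ = ½ * ½

  4ℚ : ℚ
  4ℚ = fromℕ 4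

  near-½⇒inv≤4 : ∀ d → ∣ d - ½ ∣ < ¼ → 0ℚ < d × inv d ≤ 4ℚ
  near-½⇒inv≤4 d ∣d-½∣<¼ = 0<d , inv≤4
    where
    ½-d<¼ : - (d - ½) < ¼
    ½-d<¼ = ≤-<-trans (p≤∣p∣ (- (d - ½))) (subst (_< ¼) (sym (∣-p∣≡∣p∣ (d - ½))) ∣d-½∣<¼)
    ¼<d : ¼ < d
    ¼<d = subst₂ _<_ (left d) (right d) (+-monoˡ-< (d - ¼) ½-d<¼)
      where
      left : ∀ d → - (d - ½) + (d - ¼) ≡ ¼
      left = solve-∀ ℚ-ring
      right : ∀ d → ¼ + (d - ¼) ≡ d
      right = solve-∀ ℚ-ring
    0<d : 0ℚ < d
    0<d = <-trans (positive⁻¹ ¼) ¼<d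
    inv≤4 : inv d ≤ 4ℚ
    inv≤4 = *-cancelˡ-≤-pos d {{positive 0<d}} (begin
      d * inv d   ≡⟨ inv-inverseʳ (0<⇒≢0 0<d) ⟩
      4ℚ * ¼      ≤⟨ *-monoˡ-≤-0≤ 4ℚ (0≤fromℕ 4) (<⇒≤ ¼<d) ⟩
      4ℚ * d      ≡⟨ *-comm 4ℚ d ⟩
      d * 4ℚ      ∎)
      where open ≤-Reasoning

  ratio-converges : ∀ {a d α δ : ℕ → ℚ} {L} → Null α → Null δ →
    (∀ n → ∣ a n - ½ * L ∣ ≤ α n) → (∀ n → ∣ d n - ½ ∣ ≤ δ n) →
    ConvergesTo (λ n → a n * inv (d n)) L
  ratio-converges {a} {d} {α} {δ} {L} α→0 δ→0 ∣a-½L∣≤α ∣d-½∣≤δ with δ→0 ¼ (positive⁻¹ ¼)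
  ... | N , δ<¼ = converges-by-null {λ n → a n * inv (d n)} {L} bound→0 N λ n N≤n →
    ratio-bound n (near-½⇒inv≤4 (d n) (≤-<-trans (∣d-½∣≤δ n) (δ<¼ n N≤n)))
    where
    bound : ℕ → ℚ
    bound n = 4ℚ * (α n + ∣ L ∣ * δ n)
    bound→0 : Null bound
    bound→0 = Null-scale 4ℚ (0≤fromℕ 4) (Null-+ α→0 (Null-scale ∣ L ∣ (0≤∣p∣ L) δ→0))
    ratio-bound : ∀ n → 0ℚ < d n × inv (d n) ≤ 4ℚ → ∣ a n * inv (d n) - L ∣ ≤ bound n
    ratio-bound n (0<d , inv≤4) = begin
      ∣ a n * i - L ∣                                 ≡⟨ cong ∣_∣ a/d-L ⟩
      ∣ i * ((a n - ½ * L) - L * (d n - ½)) ∣         ≤⟨ ∣c*x∣≤c*b (0≤inv 0<d) (∣p-q∣≤∣p∣+∣q∣ (a n - ½ * L) (L * (d n - ½))) ⟩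
      i * (∣ a n - ½ * L ∣ + ∣ L * (d n - ½) ∣)       ≡⟨ cong (λ y → i * (∣ a n - ½ * L ∣ + y)) (∣p*q∣≡∣p∣*∣q∣ L (d n - ½)) ⟩
      i * (∣ a n - ½ * L ∣ + ∣ L ∣ * ∣ d n - ½ ∣)     ≤⟨ *-mono-≤-0≤ (0≤inv 0<d) 0≤sum inv≤4
                                                           (+-mono-≤ (∣a-½L∣≤α n) (*-monoˡ-≤-0≤ ∣ L ∣ (0≤∣p∣ L) (∣d-½∣≤δ n))) ⟩
      bound n                                         ∎
      where
      open ≤-Reasoning
      i : ℚ
      i = inv (d n)
      0≤sum : 0ℚ ≤ ∣ a n - ½ * L ∣ + ∣ L ∣ * ∣ d n - ½ ∣
      0≤sum = +-pres-0≤ (0≤∣p∣ (a n - ½ * L)) (*-pres-0≤ (0≤∣p∣ L) (0≤∣p∣ (d n - ½)))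
      expand : ∀ a i L d → i * ((a - ½ * L) - L * (d - ½)) ≡ a * i - L * (d * i)
      expand = solve-∀ ℚ-ring
      a/d-L : a n * i - L ≡ i * ((a n - ½ * L) - L * (d n - ½))
      a/d-L = sym (begin-equality
        i * ((a n - ½ * L) - L * (d n - ½))   ≡⟨ expand (a n) i L (d n) ⟩
        a n * i - L * (d n * i)               ≡⟨ cong (λ y → a n * i - L * y) (inv-inverseʳ (0<⇒≢0 0<d)) ⟩
        a n * i - L * 1ℚ                      ≡⟨ cong (λ y → a n * i - y) (*-identityʳ L) ⟩
        a n * i - L                           ∎)

  sumOver : {A : Set} → (A → ℚ) → List A → ℚ
  sumOver h = foldr (λ x acc → h x + acc) 0ℚ

  module _ {A : Set} where

    sumOver-++ : ∀ h (xs ys : List A) → sumOver h (xs ++ ys) ≡ sumOver h xs + sumOver h ys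
    sumOver-++ h []       ys = sym (+-identityˡ _)
    sumOver-++ h (x ∷ xs) ys rewrite sumOver-++ h xs ys = sym (+-assoc (h x) _ _)

    sumOver-cong : ∀ {h h′} → (∀ x → h x ≡ h′ x) → (xs : List A) → sumOver h xs ≡ sumOver h′ xs
    sumOver-cong h≡h′ []       = refl
    sumOver-cong h≡h′ (x ∷ xs) = cong₂ _+_ (h≡h′ x) (sumOver-cong h≡h′ xs)

    sumOver-+ : ∀ h h′ (xs : List A) → sumOver (λ x → h x + h′ x) xs ≡ sumOver h xs + sumOver h′ xs
    sumOver-+ h h′ []       = refl
    sumOver-+ h h′ (x ∷ xs) rewrite sumOver-+ h h′ xs = interchange (h x) (h′ x) (sumOver h xs) (sumOver h′ xs)
      where
      interchange : ∀ a b c d → a + b + (c + d) ≡ a + c + (b + d)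
      interchange = solve-∀ ℚ-ring

    sumOver-scale : ∀ a h (xs : List A) → sumOver (λ x → a * h x) xs ≡ a * sumOver h xs
    sumOver-scale a h []       = sym (*-zeroʳ a)
    sumOver-scale a h (x ∷ xs) rewrite sumOver-scale a h xs = sym (*-distribˡ-+ a (h x) (sumOver h xs))

  sumOver-map : ∀ {A B : Set} (h : B → ℚ) (g : A → B) xs → sumOver h (map g xs) ≡ sumOver (λ x → h (g x)) xs
  sumOver-map h g []       = refl
  sumOver-map h g (x ∷ xs) = cong (λ s → h (g x) + s) (sumOver-map h g xs)

  sum0-cong : ∀ N {f g : ℕ → ℚ} → (∀ d → f d ≡ g d) → sum0 N f ≡ sum0 N g
  sum0-cong zero    f≡g = f≡g 0
  sum0-cong (suc N) f≡g = cong₂ _+_ (sum0-cong N f≡g) (f≡g (suc N))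

  sum0-linear : ∀ N a b f g → sum0 N (λ d → a * f d + b * g d) ≡ a * sum0 N f + b * sum0 N g
  sum0-linear zero    a b f g = refl
  sum0-linear (suc N) a b f g rewrite sum0-linear N a b f g = regroup a b (sum0 N f) (sum0 N g) (f (suc N)) (g (suc N))
    where
    regroup : ∀ a b F G x y → a * F + b * G + (a * x + b * y) ≡ a * (F + x) + b * (G + y)
    regroup = solve-∀ ℚ-ring

  -- The Bernoulli sum X_n

  module _ (p : ℕ) where

    -- expectFrom i k f = E f(B_i + ⋯ + B_{i+k-1}); expectXn p n is expectFrom 1 n by definition.
    expectFrom : ℕ → ℕ → (ℕ → ℚ) → ℚ
    expectFrom i k f = sumOver (λ bs → probFrom p i bs * f (count bs)) (allOutcomes k)

    expectFrom-cong : ∀ i k {f g} → (∀ d → f d ≡ g d) → expectFrom i k f ≡ expectFrom i k g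
    expectFrom-cong i k f≡g = sumOver-cong (λ bs → cong (probFrom p i bs *_) (f≡g (count bs))) (allOutcomes k)

    expectFrom-linear : ∀ i k a b f g →
      expectFrom i k (λ d → a * f d + b * g d) ≡ a * expectFrom i k f + b * expectFrom i k g
    expectFrom-linear i k a b f g = begin
      sumOver (λ bs → π bs * (a * f (count bs) + b * g (count bs))) A
        ≡⟨ sumOver-cong (λ bs → distrib (π bs) a b (f (count bs)) (g (count bs))) A ⟩
      sumOver (λ bs → a * (π bs * f (count bs)) + b * (π bs * g (count bs))) A
        ≡⟨ sumOver-+ (λ bs → a * (π bs * f (count bs))) (λ bs → b * (π bs * g (count bs))) A ⟩
      sumOver (λ bs → a * (π bs * f (count bs))) A + sumOver (λ bs → b * (π bs * g (count bs))) A
        ≡⟨ cong₂ _+_ (sumOver-scale a _ A) (sumOver-scale b _ A) ⟩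
      a * expectFrom i k f + b * expectFrom i k g ∎
      where
      open ≡-Reasoning
      A : List (Vec Bool k)
      A = allOutcomes k
      π : Vec Bool k → ℚ
      π = probFrom p i
      distrib : ∀ π a b u v → π * (a * u + b * v) ≡ a * (π * u) + b * (π * v)
      distrib = solve-∀ ℚ-ring

    expectFrom-suc : ∀ i k f → expectFrom i (suc k) f ≡
      bernoulliP p i * expectFrom (suc i) k (λ d → f (suc d)) + (1ℚ - bernoulliP p i) * expectFrom (suc i) k f
    expectFrom-suc i k f = begin
      sumOver H (map (true ∷_) A ++ map (false ∷_) A)
        ≡⟨ sumOver-++ H (map (true ∷_) A) (map (false ∷_) A) ⟩
      sumOver H (map (true ∷_) A) + sumOver H (map (false ∷_) A)
        ≡⟨ cong₂ _+_ (sumOver-map H (true ∷_) A) (sumOver-map H (false ∷_) A) ⟩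
      sumOver (λ bs → β * π bs * f (suc (count bs))) A + sumOver (λ bs → (1ℚ - β) * π bs * f (count bs)) A
        ≡⟨ cong₂ _+_ (sumOver-cong (λ bs → *-assoc β _ _) A) (sumOver-cong (λ bs → *-assoc (1ℚ - β) _ _) A) ⟩
      sumOver (λ bs → β * (π bs * f (suc (count bs)))) A + sumOver (λ bs → (1ℚ - β) * (π bs * f (count bs))) A
        ≡⟨ cong₂ _+_ (sumOver-scale β _ A) (sumOver-scale (1ℚ - β) _ A) ⟩
      β * expectFrom (suc i) k (λ d → f (suc d)) + (1ℚ - β) * expectFrom (suc i) k f ∎
      where
      open ≡-Reasoning
      A : List (Vec Bool k)
      A = allOutcomes k
      β : ℚ
      β = bernoulliP p i
      π : Vec Bool k → ℚ
      π = probFrom p (suc i)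
      H : Vec Bool (suc k) → ℚ
      H bs = probFrom p i bs * f (count bs)

    bernoulliPGF : ℕ → ℚ → ℚ
    bernoulliPGF i r = bernoulliP p i * r + (1ℚ - bernoulliP p i)

    pgfFrom : ℕ → ℕ → ℚ → ℚ
    pgfFrom i zero    r = 1ℚ
    pgfFrom i (suc k) r = bernoulliPGF i r * pgfFrom (suc i) k r

    expectFrom-geometric : ∀ i k r f → (∀ d → f (suc d) ≡ r * f d) → expectFrom i k f ≡ f 0 * pgfFrom i k r
    expectFrom-geometric i zero    r f f-geo = trans (+-identityʳ (1ℚ * f 0)) (*-comm 1ℚ (f 0))
    expectFrom-geometric i (suc k) r f f-geo = begin
      expectFrom i (suc k) f
        ≡⟨ expectFrom-suc i k f ⟩
      β * expectFrom (suc i) k (λ d → f (suc d)) + (1ℚ - β) * expectFrom (suc i) k f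
        ≡⟨ cong₂ (λ x y → β * x + (1ℚ - β) * y)
                 (expectFrom-geometric (suc i) k r (λ d → f (suc d)) (λ d → f-geo (suc d)))
                 (expectFrom-geometric (suc i) k r f f-geo) ⟩
      β * (f 1 * G) + (1ℚ - β) * (f 0 * G)
        ≡⟨ cong (λ y → β * (y * G) + (1ℚ - β) * (f 0 * G)) (f-geo 0) ⟩
      β * (r * f 0 * G) + (1ℚ - β) * (f 0 * G)
        ≡⟨ factor β r (f 0) G ⟩
      f 0 * (bernoulliPGF i r * G) ∎
      where
      open ≡-Reasoning
      β : ℚ
      β = bernoulliP p i
      G : ℚ
      G = pgfFrom (suc i) k r
      factor : ∀ β r f G → β * (r * f * G) + (1ℚ - β) * (f * G) ≡ f * ((β * r + (1ℚ - β)) * G)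
      factor = solve-∀ ℚ-ring

    pgfFrom-snoc : ∀ i k r → pgfFrom i (suc k) r ≡ pgfFrom i k r * bernoulliPGF (i ℕ.+ k) r
    pgfFrom-snoc i zero    r = trans (*-comm (bernoulliPGF i r) 1ℚ) (cong (λ j → 1ℚ * bernoulliPGF j r) (sym (ℕ.+-identityʳ i)))
    pgfFrom-snoc i (suc k) r = begin
      bernoulliPGF i r * pgfFrom (suc i) (suc k) r
        ≡⟨ cong (bernoulliPGF i r *_) (pgfFrom-snoc (suc i) k r) ⟩
      bernoulliPGF i r * (pgfFrom (suc i) k r * bernoulliPGF (suc i ℕ.+ k) r)
        ≡⟨ sym (*-assoc (bernoulliPGF i r) _ _) ⟩
      pgfFrom i (suc k) r * bernoulliPGF (suc i ℕ.+ k) r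
        ≡⟨ cong (λ j → pgfFrom i (suc k) r * bernoulliPGF j r) (sym (ℕ.+-suc i k)) ⟩
      pgfFrom i (suc k) r * bernoulliPGF (i ℕ.+ suc k) r ∎
      where open ≡-Reasoning

    pgfFrom-vanishing : ∀ i k j r → j ℕ.< k → bernoulliPGF (i ℕ.+ j) r ≡ 0ℚ → pgfFrom i k r ≡ 0ℚ
    pgfFrom-vanishing i (suc k) zero r _ φ≡0 =
      trans (cong (λ j → bernoulliPGF j r * pgfFrom (suc i) k r) (sym (ℕ.+-identityʳ i)))
            (trans (cong (_* pgfFrom (suc i) k r) φ≡0) (*-zeroˡ (pgfFrom (suc i) k r)))
    pgfFrom-vanishing i (suc k) (suc j) r (s≤s j<k) φ≡0 =
      trans (cong (bernoulliPGF i r *_) (pgfFrom-vanishing (suc i) k j r j<k (subst (λ l → bernoulliPGF l r ≡ 0ℚ) (ℕ.+-suc i j) φ≡0)))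
            (*-zeroʳ (bernoulliPGF i r))

    expectFrom-parity : ∀ i k b r f → (∀ d → f (suc d) ≡ r * f d) → pgfFrom i k (- r) ≡ 0ℚ →
      expectFrom i k (λ d → hasParity b d * f d) ≡ ½ * expectFrom i k f
    expectFrom-parity i k b r f f-geo pgf≡0 = begin
      expectFrom i k (λ d → hasParity b d * f d)
        ≡⟨ expectFrom-cong i k (λ d → trans (cong (_* f d) (hasParity≡½+sign b d)) (distrib (sign b) (σ d) (f d))) ⟩
      expectFrom i k (λ d → ½ * f d + sign b * (σ d * f d))
        ≡⟨ expectFrom-linear i k ½ (sign b) f (λ d → σ d * f d) ⟩
      ½ * expectFrom i k f + sign b * expectFrom i k (λ d → σ d * f d)
        ≡⟨ cong (λ y → ½ * expectFrom i k f + sign b * y) (expectFrom-geometric i k (- r) (λ d → σ d * f d) alternating) ⟩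
      ½ * expectFrom i k f + sign b * (1ℚ * f 0 * pgfFrom i k (- r))
        ≡⟨ cong (λ y → ½ * expectFrom i k f + sign b * (1ℚ * f 0 * y)) pgf≡0 ⟩
      ½ * expectFrom i k f + sign b * (1ℚ * f 0 * 0ℚ)
        ≡⟨ drop (expectFrom i k f) (sign b) (f 0) ⟩
      ½ * expectFrom i k f ∎
      where
      open ≡-Reasoning
      σ : ℕ → ℚ
      σ = powℚ (- 1ℚ)
      distrib : ∀ s σ f → (½ + s * σ) * f ≡ ½ * f + s * (σ * f)
      distrib = solve-∀ ℚ-ring
      swap : ∀ σ r f → - 1ℚ * σ * (r * f) ≡ - r * (σ * f)
      swap = solve-∀ ℚ-ring
      alternating : ∀ d → σ (suc d) * f (suc d) ≡ - r * (σ d * f d)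
      alternating d = trans (cong (σ (suc d) *_) (f-geo d)) (swap (σ d) r (f d))
      drop : ∀ E s c → ½ * E + s * (1ℚ * c * 0ℚ) ≡ ½ * E
      drop = solve-∀ ℚ-ring

    p^_ : ℕ → ℚ
    p^ k = fromℕ (p ℕ.^ k)

    p^-suc : ∀ k → p^ suc k ≡ fromℕ p * p^ k
    p^-suc k = fromℕ-* p (p ℕ.^ k)

    p^-+ : ∀ a b → p^ (a ℕ.+ b) ≡ p^ a * p^ b
    p^-+ a b = trans (cong fromℕ (ℕ.^-distribˡ-+-* p a b)) (fromℕ-* (p ℕ.^ a) (p ℕ.^ b))

    powℚ-p^ : ∀ k → powℚ (fromℕ p) k ≡ p^ k
    powℚ-p^ = powℚ-fromℕ p

    0≤p^ : ∀ k → 0ℚ ≤ p^ k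
    0≤p^ k = 0≤fromℕ (p ℕ.^ k)

    0<p^+1 : ∀ k → 0ℚ < p^ k + 1ℚ
    0<p^+1 k = subst (_< p^ k + 1ℚ) (+-identityʳ 0ℚ) (+-mono-≤-< (0≤p^ k) 0<1)

    bernoulliPGF-suc : ∀ t r → bernoulliPGF (suc t) r ≡ (p^ t + r) * inv (p^ t + 1ℚ)
    bernoulliPGF-suc t r = begin
      β * r + (1ℚ - β)                 ≡⟨ cong (λ y → β * r + (y - β)) (sym (inv-inverseˡ (0<⇒≢0 (0<p^+1 t)))) ⟩
      β * r + (β * (p^ t + 1ℚ) - β)    ≡⟨ collect β (p^ t) r ⟩
      (p^ t + r) * β                   ∎
      where
      open ≡-Reasoning
      β : ℚ
      β = inv (p^ t + 1ℚ)
      collect : ∀ β a r → β * r + (β * (a + 1ℚ) - β) ≡ (a + r) * β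
      collect = solve-∀ ℚ-ring

    zpow-shift : ∀ n i → zpow p (ℤ.- (+ suc n ℤ.- + suc i)) ≡ zpow p (ℤ.- (+ n ℤ.- + i))
    zpow-shift n i = cong (λ e → zpow p (ℤ.- e))
      (trans (ℤ.[+m]-[+n]≡m⊖n (suc n) (suc i)) (trans (ℤ.[1+m]⊖[1+n]≡m⊖n n i) (sym (ℤ.[+m]-[+n]≡m⊖n n i))))

    module _ .{{_ : ℕ.NonZero p}} where

      0<p^ : ∀ k → 0ℚ < p^ k
      0<p^ k = <-≤-trans 0<1 (fromℕ-mono-≤ (ℕ.m^n>0 p k))

      p^n*p^[j-n]≡p^j : ∀ n j → p^ n * zpow p (ℤ.- (+ n ℤ.- + j)) ≡ p^ j
      p^n*p^[j-n]≡p^j n j with n ℕ.≤? j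
      ... | yes n≤j = subst (λ j → p^ n * zpow p (ℤ.- (+ n ℤ.- + j)) ≡ p^ j) (ℕ.m+[n∸m]≡n n≤j) (upward (j ∸ n))
        where
        open ≡-Reasoning
        upward : ∀ t → p^ n * zpow p (ℤ.- (+ n ℤ.- + (n ℕ.+ t))) ≡ p^ (n ℕ.+ t)
        upward t = begin
          p^ n * zpow p (ℤ.- (+ n ℤ.- + (n ℕ.+ t)))
            ≡⟨ cong (λ z → p^ n * zpow p (ℤ.- z)) (trans (ℤ.[+m]-[+n]≡m⊖n n (n ℕ.+ t)) (ℤ.⊖-≤ (ℕ.m≤m+n n t))) ⟩
          p^ n * zpow p (ℤ.- (ℤ.- (+ ((n ℕ.+ t) ∸ n))))
            ≡⟨ cong (λ z → p^ n * zpow p z) (ℤ.neg-involutive (+ ((n ℕ.+ t) ∸ n))) ⟩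
          p^ n * p^ ((n ℕ.+ t) ∸ n)   ≡⟨ cong (λ z → p^ n * p^ z) (ℕ.m+n∸m≡n n t) ⟩
          p^ n * p^ t                 ≡⟨ sym (p^-+ n t) ⟩
          p^ (n ℕ.+ t)                ∎
      ... | no n≰j = subst (λ n → p^ n * zpow p (ℤ.- (+ n ℤ.- + j)) ≡ p^ j) j+[1+t]≡n (downward (n ∸ suc j))
        where
        open ≡-Reasoning
        j+[1+t]≡n : j ℕ.+ suc (n ∸ suc j) ≡ n
        j+[1+t]≡n = trans (ℕ.+-suc j (n ∸ suc j)) (ℕ.m+[n∸m]≡n (ℕ.≰⇒> n≰j))
        downward : ∀ t → p^ (j ℕ.+ suc t) * zpow p (ℤ.- (+ (j ℕ.+ suc t) ℤ.- + j)) ≡ p^ j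
        downward t = begin
          p^ (j ℕ.+ suc t) * zpow p (ℤ.- (+ (j ℕ.+ suc t) ℤ.- + j))
            ≡⟨ cong (λ z → p^ (j ℕ.+ suc t) * zpow p (ℤ.- z)) (trans (ℤ.[+m]-[+n]≡m⊖n (j ℕ.+ suc t) j) (ℤ.⊖-≥ (ℕ.m≤m+n j (suc t)))) ⟩
          p^ (j ℕ.+ suc t) * zpow p (ℤ.- (+ ((j ℕ.+ suc t) ∸ j)))
            ≡⟨ cong (λ z → p^ (j ℕ.+ suc t) * zpow p (ℤ.- (+ z))) (ℕ.m+n∸m≡n j (suc t)) ⟩
          p^ (j ℕ.+ suc t) * inv (p^ suc t)     ≡⟨ cong (_* inv (p^ suc t)) (p^-+ j (suc t)) ⟩
          p^ j * p^ suc t * inv (p^ suc t)      ≡⟨ *-assoc (p^ j) _ _ ⟩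
          p^ j * (p^ suc t * inv (p^ suc t))    ≡⟨ cong (p^ j *_) (inv-inverseʳ (0<⇒≢0 (0<p^ (suc t)))) ⟩
          p^ j * 1ℚ                             ≡⟨ *-identityʳ (p^ j) ⟩
          p^ j                                  ∎

      0≤zpow : ∀ k → 0ℚ ≤ zpow p k
      0≤zpow (+ k)     = 0≤p^ k
      0≤zpow -[1+ k ]  = 0≤inv (0<p^ (suc k))

      0<1+zpow : ∀ k → 0ℚ < 1ℚ + zpow p k
      0<1+zpow k = subst (_< 1ℚ + zpow p k) (+-identityʳ 0ℚ) (+-mono-<-≤ 0<1 (0≤zpow k))

      momentXn : ℕ → ℕ → ℚ
      momentXn n m = prod1 m (λ i → (p^ i + 1ℚ) * inv (1ℚ + zpow p (ℤ.- (+ n ℤ.- + i))))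

      [p^n+p^j]*inv[1+p^[j-n]]≡p^n : ∀ n j → (p^ n + p^ j) * inv (1ℚ + zpow p (ℤ.- (+ n ℤ.- + j))) ≡ p^ n
      [p^n+p^j]*inv[1+p^[j-n]]≡p^n n j = begin
        (p^ n + p^ j) * inv (1ℚ + z)       ≡⟨ cong (λ w → (p^ n + w) * inv (1ℚ + z)) (sym (p^n*p^[j-n]≡p^j n j)) ⟩
        (p^ n + p^ n * z) * inv (1ℚ + z)   ≡⟨ factor (p^ n) z (inv (1ℚ + z)) ⟩
        p^ n * ((1ℚ + z) * inv (1ℚ + z))   ≡⟨ cong (p^ n *_) (inv-inverseʳ (0<⇒≢0 (0<1+zpow (ℤ.- (+ n ℤ.- + j))))) ⟩
        p^ n * 1ℚ                          ≡⟨ *-identityʳ (p^ n) ⟩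
        p^ n                               ∎
        where
        open ≡-Reasoning
        z : ℚ
        z = zpow p (ℤ.- (+ n ℤ.- + j))
        factor : ∀ a z i → (a + a * z) * i ≡ a * ((1ℚ + z) * i)
        factor = solve-∀ ℚ-ring

      momentXn-suc : ∀ n m → momentXn (suc n) m ≡ momentXn n m * ((p^ n + p^ m) * inv (p^ n + 1ℚ))
      momentXn-suc n zero    = sym (trans (*-identityˡ _) (inv-inverseʳ (0<⇒≢0 (0<p^+1 n))))
      momentXn-suc n (suc m) = begin
        momentXn (suc n) m * (A * inv (1ℚ + zpow p (ℤ.- (+ suc n ℤ.- + suc m))))
          ≡⟨ cong₂ (λ x y → x * (A * inv (1ℚ + y))) (momentXn-suc n m) (zpow-shift n m) ⟩
        momentXn n m * ((p^ n + p^ m) * β) * (A * I m)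
          ≡⟨ rearrange (momentXn n m) (p^ n + p^ m) β A (I m) (p^ n + p^ suc m) (I (suc m))
               (trans ([p^n+p^j]*inv[1+p^[j-n]]≡p^n n m) (sym ([p^n+p^j]*inv[1+p^[j-n]]≡p^n n (suc m)))) ⟩
        momentXn n m * (A * I (suc m)) * ((p^ n + p^ suc m) * β) ∎
        where
        open ≡-Reasoning
        β : ℚ
        β = inv (p^ n + 1ℚ)
        A : ℚ
        A = p^ suc m + 1ℚ
        I : ℕ → ℚ
        I i = inv (1ℚ + zpow p (ℤ.- (+ n ℤ.- + i)))
        to-middle : ∀ R x β A I → R * (x * β) * (A * I) ≡ R * β * A * (x * I)
        to-middle = solve-∀ ℚ-ring
        from-middle : ∀ R y β A J → R * β * A * (y * J) ≡ R * (A * J) * (y * β)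
        from-middle = solve-∀ ℚ-ring
        rearrange : ∀ R x β A I y J → x * I ≡ y * J → R * (x * β) * (A * I) ≡ R * (A * J) * (y * β)
        rearrange R x β A I y J xI≡yJ = trans (to-middle R x β A I) (trans (cong (R * β * A *_) xI≡yJ) (from-middle R y β A J))

      momentXn-zero : ∀ m → momentXn 0 m ≡ 1ℚ
      momentXn-zero zero    = refl
      momentXn-zero (suc m) = begin
        momentXn 0 m * ((p^ suc m + 1ℚ) * inv (1ℚ + zpow p (ℤ.- (+ 0 ℤ.- + suc m))))
          ≡⟨ cong₂ (λ x y → x * ((p^ suc m + 1ℚ) * inv (1ℚ + y))) (momentXn-zero m) zpow≡p^ ⟩
        1ℚ * ((p^ suc m + 1ℚ) * inv (1ℚ + p^ suc m))
          ≡⟨ cong (λ y → 1ℚ * ((p^ suc m + 1ℚ) * inv y)) (+-comm 1ℚ (p^ suc m)) ⟩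
        1ℚ * ((p^ suc m + 1ℚ) * inv (p^ suc m + 1ℚ))
          ≡⟨ cong (1ℚ *_) (inv-inverseʳ (0<⇒≢0 (0<p^+1 (suc m)))) ⟩
        1ℚ ∎
        where
        open ≡-Reasoning
        z : ℚ
        z = zpow p (ℤ.- (+ 0 ℤ.- + suc m))
        zpow≡p^ : z ≡ p^ suc m
        zpow≡p^ = trans (sym (*-identityˡ z)) (p^n*p^[j-n]≡p^j 0 (suc m))

      pgfFrom-moment : ∀ m n → pgfFrom 1 n (p^ m) ≡ momentXn n m
      pgfFrom-moment m zero    = sym (momentXn-zero m)
      pgfFrom-moment m (suc n) = begin
        pgfFrom 1 (suc n) (p^ m)                                   ≡⟨ pgfFrom-snoc 1 n (p^ m) ⟩
        pgfFrom 1 n (p^ m) * bernoulliPGF (suc n) (p^ m)           ≡⟨ cong₂ _*_ (pgfFrom-moment m n) (bernoulliPGF-suc n (p^ m)) ⟩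
        momentXn n m * ((p^ n + p^ m) * inv (p^ n + 1ℚ))           ≡⟨ sym (momentXn-suc n m) ⟩
        momentXn (suc n) m                                         ∎
        where open ≡-Reasoning

      moment-geometric : ∀ m d → powℚ (p^ suc d) m ≡ p^ m * powℚ (p^ d) m
      moment-geometric m d = trans (cong (λ x → powℚ x m) (p^-suc d))
        (trans (powℚ-* (fromℕ p) (p^ d) m) (cong (_* powℚ (p^ d) m) (powℚ-p^ m)))

      expectXn-moment : ∀ m n → expectXn p n (λ d → powℚ (p^ d) m) ≡ momentXn n m
      expectXn-moment m n = begin
        expectFrom 1 n (λ d → powℚ (p^ d) m)      ≡⟨ expectFrom-geometric 1 n (p^ m) (λ d → powℚ (p^ d) m) (moment-geometric m) ⟩
        powℚ 1ℚ m * pgfFrom 1 n (p^ m)            ≡⟨ cong₂ _*_ (powℚ-1 m) (pgfFrom-moment m n) ⟩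
        1ℚ * momentXn n m                         ≡⟨ *-identityˡ (momentXn n m) ⟩
        momentXn n m                              ∎
        where open ≡-Reasoning

      expectXn-parity-moment : ∀ b m n → m ℕ.< n →
        expectXn p n (λ d → hasParity b d * powℚ (p^ d) m) ≡ ½ * expectXn p n (λ d → powℚ (p^ d) m)
      expectXn-parity-moment b m n m<n =
        expectFrom-parity 1 n b (p^ m) (λ d → powℚ (p^ d) m) (moment-geometric m)
          (pgfFrom-vanishing 1 n m (- p^ m) m<n (begin
            bernoulliPGF (suc m) (- p^ m)         ≡⟨ bernoulliPGF-suc m (- p^ m) ⟩
            (p^ m - p^ m) * inv (p^ m + 1ℚ)       ≡⟨ cong (_* inv (p^ m + 1ℚ)) (+-inverseʳ (p^ m)) ⟩
            0ℚ * inv (p^ m + 1ℚ)                  ≡⟨ *-zeroˡ (inv (p^ m + 1ℚ)) ⟩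
            0ℚ                                    ∎))
        where open ≡-Reasoning

      expectXn-parity : ∀ b n → 0 ℕ.< n → expectXn p n (hasParity b) ≡ ½
      expectXn-parity b n 0<n = begin
        expectXn p n (hasParity b)                        ≡⟨ expectFrom-cong 1 n (λ d → sym (*-identityʳ (hasParity b d))) ⟩
        expectXn p n (λ d → hasParity b d * powℚ (p^ d) 0) ≡⟨ expectXn-parity-moment b 0 n 0<n ⟩
        ½ * expectXn p n (λ d → powℚ (p^ d) 0)            ≡⟨ cong (½ *_) (expectXn-moment 0 n) ⟩
        ½ * 1ℚ                                            ≡⟨ *-identityʳ ½ ⟩
        ½                                                 ∎
        where open ≡-Reasoning

      condExpectXn-moment : ∀ b m n → m ℕ.< n → condExpectXn p n (λ d → powℚ (p^ d) m) b ≡ momentXn n m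
      condExpectXn-moment b m n m<n = begin
        expectXn p n (λ d → hasParity b d * E d) * inv (expectXn p n (hasParity b))
          ≡⟨ cong₂ (λ x y → x * inv y) (expectXn-parity-moment b m n m<n) (expectXn-parity b n (ℕ.≤-<-trans z≤n m<n)) ⟩
        ½ * expectXn p n E * inv ½    ≡⟨ cong (½ * expectXn p n E *_) (*≡1⇒inv≡ {½} {fromℕ 2} refl) ⟩
        ½ * expectXn p n E * fromℕ 2  ≡⟨ ½*x*2≡x (expectXn p n E) ⟩
        expectXn p n E                ≡⟨ expectXn-moment m n ⟩
        momentXn n m                  ∎
        where
        open ≡-Reasoning
        E : ℕ → ℚ
        E d = powℚ (p^ d) m
        ½*x*2≡x : ∀ x → ½ * x * fromℕ 2 ≡ x
        ½*x*2≡x = solve-∀ ℚ-ring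

    -- The variable X_Sel

    module _ (2≤p : 2 ℕ.≤ p) where

      private instance
        p≢0 : ℕ.NonZero p
        p≢0 = ℕ.>-nonZero (ℕ.<-≤-trans (s≤s z≤n) 2≤p)

      P : ℚ
      P = fromℕ p

      0<P : 0ℚ < P
      0<P = <-≤-trans 0<1 (fromℕ-mono-≤ (ℕ.≤-trans (s≤s z≤n) 2≤p))

      q : ℚ
      q = inv P

      P*q≡1 : P * q ≡ 1ℚ
      P*q≡1 = inv-inverseʳ (0<⇒≢0 0<P)

      0≤q : 0ℚ ≤ q
      0≤q = 0≤inv 0<P

      q≤½ : q ≤ ½
      q≤½ = *-cancelˡ-≤-pos P {{positive 0<P}} (begin
        P * q        ≡⟨ P*q≡1 ⟩
        fromℕ 2 * ½  ≤⟨ *-monoʳ-≤-0≤ ½ 0≤½ (fromℕ-mono-≤ 2≤p) ⟩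
        P * ½        ∎)
        where open ≤-Reasoning

      q≤1 : q ≤ 1ℚ
      q≤1 = ≤-trans q≤½ (*≤* (ℤ.+≤+ (s≤s z≤n)))

      q^_ : ℕ → ℚ
      q^ k = powℚ q k

      0≤q^ : ∀ k → 0ℚ ≤ q^ k
      0≤q^ k = 0≤powℚ k 0≤q

      q^≤1 : ∀ k → q^ k ≤ 1ℚ
      q^≤1 k = powℚ≤1 k 0≤q q≤1

      P*q^[1+k]≡q^k : ∀ k → P * q^ suc k ≡ q^ k
      P*q^[1+k]≡q^k k = trans (sym (*-assoc P q (q^ k))) (trans (cong (_* q^ k) P*q≡1) (*-identityˡ (q^ k)))

      zpow-neg≡q^ : ∀ k → zpow p (ℤ.- (+ k)) ≡ q^ k
      zpow-neg≡q^ zero    = refl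
      zpow-neg≡q^ (suc k) = *≡1⇒inv≡ {p^ suc k} {q^ suc k} (begin
        p^ suc k * q^ suc k             ≡⟨ cong (_* q^ suc k) (sym (powℚ-p^ (suc k))) ⟩
        powℚ P (suc k) * q^ suc k       ≡⟨ sym (powℚ-* P q (suc k)) ⟩
        powℚ (P * q) (suc k)            ≡⟨ cong (λ x → powℚ x (suc k)) P*q≡1 ⟩
        powℚ 1ℚ (suc k)                 ≡⟨ powℚ-1 (suc k) ⟩
        1ℚ                              ∎)
        where open ≡-Reasoning

      q^-null : Null q^_
      q^-null = Null-halving 0≤q^ 0 (λ n _ → *-monoʳ-≤-0≤ (q^ n) (0≤q^ n) q≤½)

      1≤p^[1+t]-1 : ∀ t → 1ℚ ≤ p^ suc t - 1ℚ
      1≤p^[1+t]-1 t = +-cancelʳ-≤ 1ℚ (begin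
        fromℕ 2                  ≤⟨ fromℕ-mono-≤ (ℕ.≤-trans 2≤p (ℕ.m≤m*n p (p ℕ.^ t) {{ℕ.m^n≢0 p t}})) ⟩
        p^ suc t                 ≡⟨ sym (minus-plus (p^ suc t)) ⟩
        p^ suc t - 1ℚ + 1ℚ       ∎)
        where
        open ≤-Reasoning
        minus-plus : ∀ x → x - 1ℚ + 1ℚ ≡ x
        minus-plus = solve-∀ ℚ-ring

      0<p^[1+t]-1 : ∀ t → 0ℚ < p^ suc t - 1ℚ
      0<p^[1+t]-1 t = <-≤-trans 0<1 (1≤p^[1+t]-1 t)

      0≤selWeight : ∀ d → 0ℚ ≤ selWeight p d
      0≤selWeight zero    = <⇒≤ 0<1
      0≤selWeight (suc d) = *-pres-0≤ (0≤selWeight d) (*-pres-0≤ (<⇒≤ 0<P) (0≤inv (0<p^[1+t]-1 d)))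

      selWeight≤p^ : ∀ d → selWeight p d ≤ p^ d
      selWeight≤p^ zero    = ≤-refl
      selWeight≤p^ (suc d) = begin
        selWeight p d * (P * inv (p^ suc d - 1ℚ))   ≤⟨ *-mono-≤-0≤ (0≤selWeight d) (*-pres-0≤ (<⇒≤ 0<P) (0≤inv (0<p^[1+t]-1 d)))
                                                          (selWeight≤p^ d) ratio≤P ⟩
        p^ d * P                                     ≡⟨ trans (*-comm (p^ d) P) (sym (p^-suc d)) ⟩
        p^ suc d                                     ∎
        where
        open ≤-Reasoning
        ratio≤P : P * inv (p^ suc d - 1ℚ) ≤ P
        ratio≤P = ≤-trans (*-monoˡ-≤-0≤ P (<⇒≤ 0<P) (inv≤1 (1≤p^[1+t]-1 d))) (≤-reflexive (*-identityʳ P))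

      selWeight-recurrence : ∀ d → selWeight p (suc d) * (p^ suc d - 1ℚ) ≡ P * selWeight p d
      selWeight-recurrence d = begin
        selWeight p d * (P * inv D) * D   ≡⟨ reassoc (selWeight p d) P (inv D) D ⟩
        selWeight p d * P * (inv D * D)   ≡⟨ cong (selWeight p d * P *_) (inv-inverseˡ (0<⇒≢0 (0<p^[1+t]-1 d))) ⟩
        selWeight p d * P * 1ℚ            ≡⟨ trans (*-identityʳ _) (*-comm (selWeight p d) P) ⟩
        P * selWeight p d                 ∎
        where
        open ≡-Reasoning
        D : ℚ
        D = p^ suc d - 1ℚ
        reassoc : ∀ a b c e → a * (b * c) * e ≡ a * b * (c * e)
        reassoc = solve-∀ ℚ-ring

      selPGF : ℕ → ℚ → ℚ
      selPGF N z = sum0 N (λ d → selWeight p d * powℚ z d)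

      selPGF-scale : ∀ N w → selPGF N (P * w) ≡ (1ℚ + P * w) * selPGF N w - P * w * (selWeight p N * powℚ w N)
      selPGF-scale zero    w = shape (P * w)
        where
        shape : ∀ x → 1ℚ * 1ℚ ≡ (1ℚ + x) * (1ℚ * 1ℚ) - x * (1ℚ * 1ℚ)
        shape = solve-∀ ℚ-ring
      selPGF-scale (suc N) w = begin
        selPGF N (P * w) + a * powℚ (P * w) (suc N)
          ≡⟨ cong₂ _+_ (selPGF-scale N w) (cong (a *_) (trans (powℚ-* P w (suc N)) (cong (_* powℚ w (suc N)) (powℚ-p^ (suc N))))) ⟩
        (1ℚ + P * w) * F - P * w * (b * W) + a * (Q * (w * W))
          ≡⟨ cong (λ z → (1ℚ + P * w) * F - z + a * (Q * (w * W))) (trans (regroup P w b W) (cong (w * W *_) (sym (selWeight-recurrence N)))) ⟩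
        (1ℚ + P * w) * F - w * W * (a * (Q - 1ℚ)) + a * (Q * (w * W))
          ≡⟨ collect P w F W a Q ⟩
        (1ℚ + P * w) * (F + a * (w * W)) - P * w * (a * (w * W)) ∎
        where
        open ≡-Reasoning
        F : ℚ
        F = selPGF N w
        W : ℚ
        W = powℚ w N
        a : ℚ
        a = selWeight p (suc N)
        b : ℚ
        b = selWeight p N
        Q : ℚ
        Q = p^ suc N
        regroup : ∀ P w b W → P * w * (b * W) ≡ w * W * (P * b)
        regroup = solve-∀ ℚ-ring
        collect : ∀ P w F W a Q → (1ℚ + P * w) * F - w * W * (a * (Q - 1ℚ)) + a * (Q * (w * W))
                                ≡ (1ℚ + P * w) * (F + a * (w * W)) - P * w * (a * (w * W))
        collect = solve-∀ ℚ-ring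

      selTail : ℕ → ℕ → ℚ
      selTail m N = selWeight p N * powℚ (p^ m) N

      momentSel : ℕ → ℚ
      momentSel m = prod1 m (λ i → p^ i + 1ℚ)

      errorConst : ℕ → ℚ
      errorConst zero    = 1ℚ
      errorConst (suc m) = (1ℚ + p^ suc m) * errorConst m + p^ suc m

      0≤1+p^ : ∀ m → 0ℚ ≤ 1ℚ + p^ m
      0≤1+p^ m = +-pres-0≤ (<⇒≤ 0<1) (0≤p^ m)

      0≤errorConst : ∀ m → 0ℚ ≤ errorConst m
      0≤errorConst zero    = <⇒≤ 0<1
      0≤errorConst (suc m) = +-pres-0≤ (*-pres-0≤ (0≤1+p^ (suc m)) (0≤errorConst m)) (0≤p^ (suc m))

      0≤momentSel : ∀ m → 0ℚ ≤ momentSel m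
      0≤momentSel zero    = <⇒≤ 0<1
      0≤momentSel (suc m) = *-pres-0≤ (0≤momentSel m) (+-pres-0≤ (0≤p^ (suc m)) (<⇒≤ 0<1))

      0≤selTail : ∀ m N → 0ℚ ≤ selTail m N
      0≤selTail m N = *-pres-0≤ (0≤selWeight N) (0≤powℚ N (0≤p^ m))

      selTail-mono : ∀ m N → selTail m N ≤ selTail (suc m) N
      selTail-mono m N = *-monoˡ-≤-0≤ (selWeight p N) (0≤selWeight N)
        (subst₂ _≤_ (sym (powℚ-fromℕ (p ℕ.^ m) N)) (sym (powℚ-fromℕ (p ℕ.^ suc m) N))
          (fromℕ-mono-≤ (ℕ.^-monoˡ-≤ N (ℕ.^-monoʳ-≤ p (ℕ.n≤1+n m)))))

      error-step : ∀ m N {c Z E} → ∣ c ∣ ≤ 1ℚ + p^ suc m → ∣ Z ∣ ≤ errorConst m * selTail m N → ∣ E ∣ ≤ selTail m N →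
        ∣ c * Z + p^ suc m * E ∣ ≤ errorConst (suc m) * selTail (suc m) N
      error-step m N {c} {Z} {E} ∣c∣≤ ∣Z∣≤ ∣E∣≤ = begin
        ∣ c * Z + Q * E ∣                                      ≤⟨ ∣p+q∣≤∣p∣+∣q∣ (c * Z) (Q * E) ⟩
        ∣ c * Z ∣ + ∣ Q * E ∣                                  ≤⟨ +-mono-≤ ∣cZ∣≤ (∣c*x∣≤c*b (0≤p^ (suc m)) ∣E∣≤) ⟩
        (1ℚ + Q) * (errorConst m * selTail m N) + Q * selTail m N  ≡⟨ collect (1ℚ + Q) (errorConst m) (selTail m N) Q ⟩
        errorConst (suc m) * selTail m N                           ≤⟨ *-monoˡ-≤-0≤ _ (0≤errorConst (suc m)) (selTail-mono m N) ⟩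
        errorConst (suc m) * selTail (suc m) N                     ∎
        where
        open ≤-Reasoning
        Q : ℚ
        Q = p^ suc m
        ∣cZ∣≤ : ∣ c * Z ∣ ≤ (1ℚ + Q) * (errorConst m * selTail m N)
        ∣cZ∣≤ = ≤-trans (≤-reflexive (∣p*q∣≡∣p∣*∣q∣ c Z)) (*-mono-≤-0≤ (0≤∣p∣ c) (0≤∣p∣ Z) ∣c∣≤ ∣Z∣≤)
        collect : ∀ a k b q → a * (k * b) + q * b ≡ (a * k + q) * b
        collect = solve-∀ ℚ-ring

      selPGF-p^-error : ∀ m N → ∣ selPGF N (p^ m) - momentSel m * selPGF N 1ℚ ∣ ≤ errorConst m * selTail m N
      selPGF-p^-error zero N = ≤-trans (≤-reflexive (cong ∣_∣ (cancel (selPGF N 1ℚ)))) (*-pres-0≤ (<⇒≤ 0<1) (0≤selTail 0 N))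
        where
        cancel : ∀ x → x - 1ℚ * x ≡ 0ℚ
        cancel = solve-∀ ℚ-ring
      selPGF-p^-error (suc m) N = ≤-trans (≤-reflexive (cong ∣_∣ split))
        (error-step m N (≤-reflexive (0≤p⇒∣p∣≡p (0≤1+p^ (suc m)))) (selPGF-p^-error m N)
          (≤-reflexive (∣-x∣≡x (0≤selTail m N))))
        where
        open ≡-Reasoning
        Q : ℚ
        Q = p^ suc m
        F : ℚ
        F = selPGF N (p^ m)
        F₁ : ℚ
        F₁ = selPGF N 1ℚ
        Π : ℚ
        Π = momentSel m
        regroup : ∀ x F E F₁ Π → (1ℚ + x) * F - x * E - Π * (x + 1ℚ) * F₁ ≡ (1ℚ + x) * (F - Π * F₁) + x * (- E)
        regroup = solve-∀ ℚ-ring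
        split : selPGF N Q - Π * (Q + 1ℚ) * F₁ ≡ (1ℚ + Q) * (F - Π * F₁) + Q * (- selTail m N)
        split = begin
          selPGF N Q - Π * (Q + 1ℚ) * F₁
            ≡⟨ cong (λ z → selPGF N z - Π * (z + 1ℚ) * F₁) (p^-suc m) ⟩
          selPGF N (P * p^ m) - Π * (P * p^ m + 1ℚ) * F₁
            ≡⟨ cong (λ z → z - Π * (P * p^ m + 1ℚ) * F₁) (selPGF-scale N (p^ m)) ⟩
          (1ℚ + P * p^ m) * F - P * p^ m * selTail m N - Π * (P * p^ m + 1ℚ) * F₁
            ≡⟨ regroup (P * p^ m) F (selTail m N) F₁ Π ⟩
          (1ℚ + P * p^ m) * (F - Π * F₁) + P * p^ m * (- selTail m N)
            ≡⟨ cong (λ z → (1ℚ + z) * (F - Π * F₁) + z * (- selTail m N)) (sym (p^-suc m)) ⟩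
          (1ℚ + Q) * (F - Π * F₁) + Q * (- selTail m N) ∎

      selPGF-neg-p^-bound : ∀ m N → ∣ selPGF N (- p^ m) ∣ ≤ errorConst m * selTail m N
      selPGF-neg-p^-bound zero N = begin
        ∣ selPGF N (- 1ℚ) ∣            ≡⟨ cong (λ z → ∣ selPGF N z ∣) -1≡P*-q ⟩
        ∣ selPGF N (P * - q) ∣         ≡⟨ cong ∣_∣ (trans (selPGF-scale N (- q)) collapse) ⟩
        ∣ selWeight p N * W ∣          ≤⟨ ∣c*x∣≤c*b (0≤selWeight N) ∣W∣≤1 ⟩
        selWeight p N * 1ℚ             ≡⟨ sym (trans (*-identityˡ _) (cong (selWeight p N *_) (powℚ-1 N))) ⟩
        errorConst 0 * selTail 0 N     ∎
        where
        open ≤-Reasoning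
        W : ℚ
        W = powℚ (- q) N
        -1≡P*-q : - 1ℚ ≡ P * - q
        -1≡P*-q = trans (cong -_ (sym P*q≡1)) (neg-distribʳ-* P q)
        ∣W∣≤1 : ∣ W ∣ ≤ 1ℚ
        ∣W∣≤1 = ≤-trans (≤-reflexive (∣powℚ-neg∣ N 0≤q)) (powℚ≤1 N 0≤q q≤1)
        regroup : ∀ P q F U → (1ℚ + P * - q) * F - P * - q * U ≡ (1ℚ - P * q) * F + P * q * U
        regroup = solve-∀ ℚ-ring
        vanish : ∀ F U → (1ℚ - 1ℚ) * F + 1ℚ * U ≡ U
        vanish = solve-∀ ℚ-ring
        collapse : (1ℚ + P * - q) * selPGF N (- q) - P * - q * (selWeight p N * W) ≡ selWeight p N * W
        collapse = trans (regroup P q (selPGF N (- q)) (selWeight p N * W))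
          (trans (cong (λ z → (1ℚ - z) * selPGF N (- q) + z * (selWeight p N * W)) P*q≡1) (vanish (selPGF N (- q)) (selWeight p N * W)))
      selPGF-neg-p^-bound (suc m) N = ≤-trans (≤-reflexive (cong ∣_∣ split)) (error-step m N ∣1-Q∣≤ (selPGF-neg-p^-bound m N) ∣E∣≤)
        where
        open ≡-Reasoning
        Q : ℚ
        Q = p^ suc m
        F : ℚ
        F = selPGF N (- p^ m)
        E : ℚ
        E = selWeight p N * powℚ (- p^ m) N
        ∣1-Q∣≤ : ∣ 1ℚ - Q ∣ ≤ 1ℚ + Q
        ∣1-Q∣≤ = ≤-trans (∣p-q∣≤∣p∣+∣q∣ 1ℚ Q) (≤-reflexive (cong (λ y → 1ℚ + y) (0≤p⇒∣p∣≡p (0≤p^ (suc m)))))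
        ∣E∣≤ : ∣ E ∣ ≤ selTail m N
        ∣E∣≤ = ≤-reflexive (trans (∣p*q∣≡∣p∣*∣q∣ (selWeight p N) _)
          (cong₂ _*_ (0≤p⇒∣p∣≡p (0≤selWeight N)) (∣powℚ-neg∣ N (0≤p^ m))))
        regroup : ∀ P x F U → (1ℚ + P * - x) * F - P * - x * U ≡ (1ℚ - P * x) * F + P * x * U
        regroup = solve-∀ ℚ-ring
        split : selPGF N (- Q) ≡ (1ℚ - Q) * F + Q * E
        split = begin
          selPGF N (- Q)                            ≡⟨ cong (λ z → selPGF N (- z)) (p^-suc m) ⟩
          selPGF N (- (P * p^ m))                   ≡⟨ cong (selPGF N) (neg-distribʳ-* P (p^ m)) ⟩
          selPGF N (P * - p^ m)                     ≡⟨ selPGF-scale N (- p^ m) ⟩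
          (1ℚ + P * - p^ m) * F - P * - p^ m * E    ≡⟨ regroup P (p^ m) F E ⟩
          (1ℚ - P * p^ m) * F + P * p^ m * E        ≡⟨ cong (λ z → (1ℚ - z) * F + z * E) (sym (p^-suc m)) ⟩
          (1ℚ - Q) * F + Q * E                      ∎

      ∏1+q^ : ℕ → ℚ
      ∏1+q^ zero    = 1ℚ
      ∏1+q^ (suc k) = ∏1+q^ k * (1ℚ + q^ k)

      ∏1+q^⁻¹ : ℕ → ℚ
      ∏1+q^⁻¹ zero    = 1ℚ
      ∏1+q^⁻¹ (suc k) = ∏1+q^⁻¹ k * inv (1ℚ + q^ k)

      1≤1+q^ : ∀ k → 1ℚ ≤ 1ℚ + q^ k
      1≤1+q^ k = ≤-trans (≤-reflexive (sym (+-identityʳ 1ℚ))) (+-monoʳ-≤ 1ℚ (0≤q^ k))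

      0<1+q^ : ∀ k → 0ℚ < 1ℚ + q^ k
      0<1+q^ k = <-≤-trans 0<1 (1≤1+q^ k)

      0≤∏1+q^ : ∀ k → 0ℚ ≤ ∏1+q^ k
      0≤∏1+q^ zero    = <⇒≤ 0<1
      0≤∏1+q^ (suc k) = *-pres-0≤ (0≤∏1+q^ k) (<⇒≤ (0<1+q^ k))

      0≤∏1+q^⁻¹ : ∀ k → 0ℚ ≤ ∏1+q^⁻¹ k
      0≤∏1+q^⁻¹ zero    = <⇒≤ 0<1
      0≤∏1+q^⁻¹ (suc k) = *-pres-0≤ (0≤∏1+q^⁻¹ k) (0≤inv (0<1+q^ k))

      ∏1+q^⁻¹*∏1+q^≡1 : ∀ k → ∏1+q^⁻¹ k * ∏1+q^ k ≡ 1ℚ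
      ∏1+q^⁻¹*∏1+q^≡1 zero    = refl
      ∏1+q^⁻¹*∏1+q^≡1 (suc k) = begin
        ∏1+q^⁻¹ k * inv (1ℚ + q^ k) * (∏1+q^ k * (1ℚ + q^ k))   ≡⟨ interchange (∏1+q^⁻¹ k) (inv (1ℚ + q^ k)) (∏1+q^ k) (1ℚ + q^ k) ⟩
        ∏1+q^⁻¹ k * ∏1+q^ k * (inv (1ℚ + q^ k) * (1ℚ + q^ k))   ≡⟨ cong₂ _*_ (∏1+q^⁻¹*∏1+q^≡1 k) (inv-inverseˡ (0<⇒≢0 (0<1+q^ k))) ⟩
        1ℚ                                                       ∎
        where
        open ≡-Reasoning
        interchange : ∀ a i b x → a * i * (b * x) ≡ a * b * (i * x)
        interchange = solve-∀ ℚ-ring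

      ∏1+q^⁻¹*∏1+q^≤1 : ∀ {k K} → k ℕ.≤ K → ∏1+q^⁻¹ K * ∏1+q^ k ≤ 1ℚ
      ∏1+q^⁻¹*∏1+q^≤1 {k} {K} k≤K = subst (λ K → ∏1+q^⁻¹ K * ∏1+q^ k ≤ 1ℚ) (ℕ.m+[n∸m]≡n k≤K) (extend (K ∸ k))
        where
        extend : ∀ t → ∏1+q^⁻¹ (k ℕ.+ t) * ∏1+q^ k ≤ 1ℚ
        extend zero    rewrite ℕ.+-identityʳ k = ≤-reflexive (∏1+q^⁻¹*∏1+q^≡1 k)
        extend (suc t) rewrite ℕ.+-suc k t = ≤-trans (≤-reflexive (swap (∏1+q^⁻¹ (k ℕ.+ t)) (inv (1ℚ + q^ (k ℕ.+ t))) (∏1+q^ k)))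
          (*-mono-≤-0≤ (*-pres-0≤ (0≤∏1+q^⁻¹ (k ℕ.+ t)) (0≤∏1+q^ k)) (0≤inv (0<1+q^ (k ℕ.+ t))) (extend t) (inv≤1 (1≤1+q^ (k ℕ.+ t))))
          where
          swap : ∀ a i b → a * i * b ≡ (a * b) * i
          swap = solve-∀ ℚ-ring

      cPartial≡∏1+q^⁻¹ : ∀ N → cPartial p N ≡ ∏1+q^⁻¹ (suc N)
      cPartial≡∏1+q^⁻¹ zero    = sym (*-identityˡ _)
      cPartial≡∏1+q^⁻¹ (suc N) = cong₂ (λ x y → x * inv (1ℚ + y)) (cPartial≡∏1+q^⁻¹ N) (zpow-neg≡q^ (suc N))

      0≤cPartial : ∀ N → 0ℚ ≤ cPartial p N
      0≤cPartial N = subst (0ℚ ≤_) (sym (cPartial≡∏1+q^⁻¹ N)) (0≤∏1+q^⁻¹ (suc N))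

      cPartial≤1 : ∀ N → cPartial p N ≤ 1ℚ
      cPartial≤1 N = subst (_≤ 1ℚ) (trans (*-identityʳ _) (sym (cPartial≡∏1+q^⁻¹ N))) (∏1+q^⁻¹*∏1+q^≤1 {0} {suc N} z≤n)

      rescaleError : ℕ → ℕ → ℚ
      rescaleError N k = q^ k * (selWeight p N * powℚ (q^ suc k) N)

      accumulatedError : ℕ → ℕ → ℚ
      accumulatedError N zero    = 0ℚ
      accumulatedError N (suc k) = accumulatedError N k + ∏1+q^ k * rescaleError N k

      selPGF-q^ : ∀ N k → selPGF N (q^ k) ≡ (1ℚ + q^ k) * selPGF N (q^ suc k) - rescaleError N k
      selPGF-q^ N k = begin
        selPGF N (q^ k)                 ≡⟨ cong (selPGF N) (sym (P*q^[1+k]≡q^k k)) ⟩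
        selPGF N (P * q^ suc k)         ≡⟨ selPGF-scale N (q^ suc k) ⟩
        (1ℚ + P * q^ suc k) * selPGF N (q^ suc k) - P * q^ suc k * (selWeight p N * powℚ (q^ suc k) N)
          ≡⟨ cong (λ z → (1ℚ + z) * selPGF N (q^ suc k) - z * (selWeight p N * powℚ (q^ suc k) N)) (P*q^[1+k]≡q^k k) ⟩
        (1ℚ + q^ k) * selPGF N (q^ suc k) - rescaleError N k ∎
        where open ≡-Reasoning

      selPGF-1-telescope : ∀ N K → selPGF N 1ℚ ≡ ∏1+q^ K * selPGF N (q^ K) - accumulatedError N K
      selPGF-1-telescope N zero    = sym (trivial (selPGF N 1ℚ))
        where
        trivial : ∀ x → 1ℚ * x - 0ℚ ≡ x
        trivial = solve-∀ ℚ-ring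
      selPGF-1-telescope N (suc K) = begin
        selPGF N 1ℚ                                                  ≡⟨ selPGF-1-telescope N K ⟩
        ∏1+q^ K * selPGF N (q^ K) - accumulatedError N K             ≡⟨ cong (λ z → ∏1+q^ K * z - accumulatedError N K) (selPGF-q^ N K) ⟩
        ∏1+q^ K * ((1ℚ + q^ K) * selPGF N (q^ suc K) - rescaleError N K) - accumulatedError N K
          ≡⟨ regroup (∏1+q^ K) (q^ K) (selPGF N (q^ suc K)) (rescaleError N K) (accumulatedError N K) ⟩
        ∏1+q^ (suc K) * selPGF N (q^ suc K) - accumulatedError N (suc K) ∎
        where
        open ≡-Reasoning
        regroup : ∀ A x F e C → A * ((1ℚ + x) * F - e) - C ≡ A * (1ℚ + x) * F - (C + A * e)
        regroup = solve-∀ ℚ-ring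

      0≤rescaleError : ∀ N k → 0ℚ ≤ rescaleError N k
      0≤rescaleError N k = *-pres-0≤ (0≤q^ k) (*-pres-0≤ (0≤selWeight N) (0≤powℚ N (0≤q^ (suc k))))

      rescaleError≤selWeight : ∀ N k → rescaleError N k ≤ selWeight p N
      rescaleError≤selWeight N k = begin
        q^ k * (selWeight p N * powℚ (q^ suc k) N)   ≤⟨ *-mono-≤-0≤ (0≤q^ k) (*-pres-0≤ (0≤selWeight N) (0≤powℚ N (0≤q^ (suc k)))) (q^≤1 k)
                                                          (*-monoˡ-≤-0≤ _ (0≤selWeight N) (powℚ≤1 N (0≤q^ (suc k)) (q^≤1 (suc k)))) ⟩
        1ℚ * (selWeight p N * 1ℚ)                    ≡⟨ trans (*-identityˡ _) (*-identityʳ (selWeight p N)) ⟩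
        selWeight p N                                ∎
        where open ≤-Reasoning

      0≤accumulatedError : ∀ N K → 0ℚ ≤ accumulatedError N K
      0≤accumulatedError N zero    = ≤-refl
      0≤accumulatedError N (suc K) = +-pres-0≤ (0≤accumulatedError N K) (*-pres-0≤ (0≤∏1+q^ K) (0≤rescaleError N K))

      cPartial*accumulatedError≤ : ∀ N K → K ℕ.≤ suc N → cPartial p N * accumulatedError N K ≤ fromℕ K * selWeight p N
      cPartial*accumulatedError≤ N zero    _     = ≤-reflexive (trans (*-zeroʳ (cPartial p N)) (sym (*-zeroˡ (selWeight p N))))
      cPartial*accumulatedError≤ N (suc K) K<1+N = begin
        c * (accumulatedError N K + ∏1+q^ K * rescaleError N K)    ≡⟨ distrib c (accumulatedError N K) (∏1+q^ K) (rescaleError N K) ⟩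
        c * accumulatedError N K + c * ∏1+q^ K * rescaleError N K
          ≤⟨ +-mono-≤ (cPartial*accumulatedError≤ N K K≤1+N)
                      (*-mono-≤-0≤ (*-pres-0≤ (0≤cPartial N) (0≤∏1+q^ K)) (0≤rescaleError N K) c*∏≤1 (rescaleError≤selWeight N K)) ⟩
        fromℕ K * selWeight p N + 1ℚ * selWeight p N               ≡⟨ sym (*-distribʳ-+ (selWeight p N) (fromℕ K) 1ℚ) ⟩
        (fromℕ K + 1ℚ) * selWeight p N                             ≡⟨ cong (_* selWeight p N) (trans (sym (fromℕ-+ K 1)) (cong fromℕ (ℕ.+-comm K 1))) ⟩
        fromℕ (suc K) * selWeight p N                              ∎
        where
        open ≤-Reasoning
        c : ℚ
        c = cPartial p N
        K≤1+N : K ℕ.≤ suc N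
        K≤1+N = ℕ.≤-trans (ℕ.n≤1+n K) K<1+N
        c*∏≤1 : c * ∏1+q^ K ≤ 1ℚ
        c*∏≤1 = subst (λ z → z * ∏1+q^ K ≤ 1ℚ) (sym (cPartial≡∏1+q^⁻¹ N)) (∏1+q^⁻¹*∏1+q^≤1 K≤1+N)
        distrib : ∀ c C A e → c * (C + A * e) ≡ c * C + c * A * e
        distrib = solve-∀ ℚ-ring

      cPartial*selPGF-1-error : ∀ N → ∣ cPartial p N * selPGF N 1ℚ - selPGF N (q^ suc N) ∣ ≤ fromℕ (suc N) * selWeight p N
      cPartial*selPGF-1-error N = begin
        ∣ c * selPGF N 1ℚ - F ∣                   ≡⟨ cong (λ z → ∣ c * z - F ∣) (selPGF-1-telescope N (suc N)) ⟩
        ∣ c * (∏1+q^ (suc N) * F - E) - F ∣       ≡⟨ cong ∣_∣ (regroup c (∏1+q^ (suc N)) F E) ⟩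
        ∣ (c * ∏1+q^ (suc N) - 1ℚ) * F - c * E ∣  ≡⟨ cong (λ z → ∣ (z - 1ℚ) * F - c * E ∣) c*∏≡1 ⟩
        ∣ (1ℚ - 1ℚ) * F - c * E ∣                 ≡⟨ cong ∣_∣ (vanish F (c * E)) ⟩
        ∣ - (c * E) ∣                             ≡⟨ ∣-x∣≡x (*-pres-0≤ (0≤cPartial N) (0≤accumulatedError N (suc N))) ⟩
        c * E                                     ≤⟨ cPartial*accumulatedError≤ N (suc N) ℕ.≤-refl ⟩
        fromℕ (suc N) * selWeight p N             ∎
        where
        open ≤-Reasoning
        c : ℚ
        c = cPartial p N
        F : ℚ
        F = selPGF N (q^ suc N)
        E : ℚ
        E = accumulatedError N (suc N)
        c*∏≡1 : c * ∏1+q^ (suc N) ≡ 1ℚ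
        c*∏≡1 = trans (cong (_* ∏1+q^ (suc N)) (cPartial≡∏1+q^⁻¹ N)) (∏1+q^⁻¹*∏1+q^≡1 (suc N))
        regroup : ∀ c A F E → c * (A * F - E) - F ≡ (c * A - 1ℚ) * F - c * E
        regroup = solve-∀ ℚ-ring
        vanish : ∀ F X → (1ℚ - 1ℚ) * F - X ≡ - X
        vanish = solve-∀ ℚ-ring

      module _ {w x : ℚ} (0≤w : 0ℚ ≤ w) (P*w≡x : P * w ≡ x) (x≤½ : x ≤ ½) where

        selWeight*w^≤x^ : ∀ d → selWeight p d * powℚ w d ≤ powℚ x d
        selWeight*w^≤x^ d = begin
          selWeight p d * powℚ w d   ≤⟨ *-monoʳ-≤-0≤ (powℚ w d) (0≤powℚ d 0≤w) (selWeight≤p^ d) ⟩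
          p^ d * powℚ w d            ≡⟨ cong (_* powℚ w d) (sym (powℚ-p^ d)) ⟩
          powℚ P d * powℚ w d        ≡⟨ sym (powℚ-* P w d) ⟩
          powℚ (P * w) d             ≡⟨ cong (λ y → powℚ y d) P*w≡x ⟩
          powℚ x d                   ∎
          where open ≤-Reasoning

        selPGF-excess : ∀ M → 0ℚ ≤ selPGF M w - 1ℚ × selPGF M w - 1ℚ + fromℕ 2 * powℚ x (suc M) ≤ fromℕ 2 * x
        selPGF-excess zero    = ≤-reflexive refl , ≤-reflexive (base x)
          where
          base : ∀ x → 1ℚ * 1ℚ - 1ℚ + fromℕ 2 * (x * 1ℚ) ≡ fromℕ 2 * x
          base = solve-∀ ℚ-ring
        selPGF-excess (suc M) with selPGF-excess M
        ... | 0≤excess , excess≤ = subst (0ℚ ≤_) (sym next) (+-pres-0≤ 0≤excess 0≤t) , (begin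
          selPGF (suc M) w - 1ℚ + fromℕ 2 * (x * X)   ≡⟨ cong (_+ fromℕ 2 * (x * X)) next ⟩
          e + t + fromℕ 2 * (x * X)                   ≡⟨ regroup e t x X ⟩
          e + (t + fromℕ 2 * x * X)                   ≤⟨ +-monoʳ-≤ e (+-mono-≤ (selWeight*w^≤x^ (suc M)) 2x*X≤X) ⟩
          e + (X + X)                                 ≡⟨ double e X ⟩
          e + fromℕ 2 * X                             ≤⟨ excess≤ ⟩
          fromℕ 2 * x                                 ∎)
          where
          open ≤-Reasoning
          e : ℚ
          e = selPGF M w - 1ℚ
          t : ℚ
          t = selWeight p (suc M) * powℚ w (suc M)
          X : ℚ
          X = powℚ x (suc M)
          0≤t : 0ℚ ≤ t
          0≤t = *-pres-0≤ (0≤selWeight (suc M)) (0≤powℚ (suc M) 0≤w)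
          0≤x : 0ℚ ≤ x
          0≤x = subst (0ℚ ≤_) P*w≡x (*-pres-0≤ (<⇒≤ 0<P) 0≤w)
          2x*X≤X : fromℕ 2 * x * X ≤ X
          2x*X≤X = ≤-trans (*-monoʳ-≤-0≤ X (0≤powℚ (suc M) 0≤x) (*-monoˡ-≤-0≤ (fromℕ 2) (0≤fromℕ 2) x≤½)) (≤-reflexive (*-identityˡ X))
          shift : ∀ S t → S + t - 1ℚ ≡ S - 1ℚ + t
          shift = solve-∀ ℚ-ring
          next : selPGF (suc M) w - 1ℚ ≡ e + t
          next = shift (selPGF M w) t
          regroup : ∀ e t x X → e + t + fromℕ 2 * (x * X) ≡ e + (t + fromℕ 2 * x * X)
          regroup = solve-∀ ℚ-ring
          double : ∀ e X → e + (X + X) ≡ e + fromℕ 2 * X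
          double = solve-∀ ℚ-ring

      q^[1+k]≤½ : ∀ k → q^ suc k ≤ ½
      q^[1+k]≤½ k = ≤-trans (*-mono-≤-0≤ 0≤q (0≤q^ k) q≤½ (q^≤1 k)) (≤-reflexive (*-identityʳ ½))

      ∣selPGF[q^[1+N]]-1∣≤2q^N : ∀ N → ∣ selPGF N (q^ suc N) - 1ℚ ∣ ≤ fromℕ 2 * q^ N
      ∣selPGF[q^[1+N]]-1∣≤2q^N zero    = *-pres-0≤ (0≤fromℕ 2) (<⇒≤ 0<1)
      ∣selPGF[q^[1+N]]-1∣≤2q^N (suc N) = begin
        ∣ e ∣                                          ≡⟨ 0≤p⇒∣p∣≡p (proj₁ excess) ⟩
        e                                              ≤⟨ ≤-trans (≤-reflexive (sym (+-identityʳ e))) (+-monoʳ-≤ e 0≤2X) ⟩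
        e + fromℕ 2 * powℚ (q^ suc N) (suc (suc N))    ≤⟨ proj₂ excess ⟩
        fromℕ 2 * q^ suc N                             ∎
        where
        open ≤-Reasoning
        e : ℚ
        e = selPGF (suc N) (q^ suc (suc N)) - 1ℚ
        excess : 0ℚ ≤ e × e + fromℕ 2 * powℚ (q^ suc N) (suc (suc N)) ≤ fromℕ 2 * q^ suc N
        excess = selPGF-excess (0≤q^ (suc (suc N))) (P*q^[1+k]≡q^k (suc N)) (q^[1+k]≤½ N) (suc N)
        0≤2X : 0ℚ ≤ fromℕ 2 * powℚ (q^ suc N) (suc (suc N))
        0≤2X = *-pres-0≤ (0≤fromℕ 2) (0≤powℚ (suc (suc N)) (0≤q^ (suc N)))

      2p^[1+m]+1≤p^[1+N] : ∀ m N → suc (suc m) ℕ.≤ N → 2 ℕ.* p ℕ.^ suc m ℕ.+ 1 ℕ.≤ p ℕ.^ suc N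
      2p^[1+m]+1≤p^[1+N] m N 2+m≤N = begin
        2 ℕ.* y ℕ.+ 1          ≤⟨ ℕ.+-monoʳ-≤ (2 ℕ.* y) (ℕ.≤-trans (ℕ.m^n>0 p (suc m)) (ℕ.m≤m+n y (y ℕ.+ 0))) ⟩
        2 ℕ.* y ℕ.+ 2 ℕ.* y    ≡⟨ cong (2 ℕ.* y ℕ.+_) (sym (ℕ.+-identityʳ (2 ℕ.* y))) ⟩
        2 ℕ.* (2 ℕ.* y)        ≤⟨ ℕ.*-mono-≤ 2≤p (ℕ.*-mono-≤ 2≤p ℕ.≤-refl) ⟩
        p ℕ.^ suc (suc (suc m))  ≤⟨ ℕ.^-monoʳ-≤ p (s≤s 2+m≤N) ⟩
        p ℕ.^ suc N            ∎
        where
        open ℕ.≤-Reasoning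
        y : ℕ
        y = p ℕ.^ suc m

      selTail-null : ∀ m → Null (selTail m)
      selTail-null m = Null-halving (0≤selTail m) (suc (suc m)) halving
        where
        halving : ∀ N → suc (suc m) ℕ.≤ N → selTail m (suc N) ≤ ½ * selTail m N
        halving N 2+m≤N = begin
          selWeight p N * (P * inv D) * (p^ m * powℚ (p^ m) N)   ≡⟨ regroup (selWeight p N) P (inv D) (p^ m) (powℚ (p^ m) N) ⟩
          selTail m N * (P * p^ m * inv D)                       ≡⟨ cong (λ z → selTail m N * (z * inv D)) (sym (p^-suc m)) ⟩
          selTail m N * (p^ suc m * inv D)
            ≤⟨ *-monoˡ-≤-0≤ (selTail m N) (0≤selTail m N) (x*inv≤½ {p^ suc m} {D} (0<p^[1+t]-1 N) 2p^[1+m]≤D) ⟩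
          selTail m N * ½                                        ≡⟨ *-comm (selTail m N) ½ ⟩
          ½ * selTail m N                                        ∎
          where
          open ≤-Reasoning
          D : ℚ
          D = p^ suc N - 1ℚ
          regroup : ∀ u P i y Y → u * (P * i) * (y * Y) ≡ u * Y * (P * y * i)
          regroup = solve-∀ ℚ-ring
          minus-plus : ∀ x → x ≡ x - 1ℚ + 1ℚ
          minus-plus = solve-∀ ℚ-ring
          2p^[1+m]≤D : fromℕ 2 * p^ suc m ≤ D
          2p^[1+m]≤D = +-cancelʳ-≤ 1ℚ (begin
            fromℕ 2 * p^ suc m + 1ℚ           ≡⟨ sym (trans (fromℕ-+ (2 ℕ.* p ℕ.^ suc m) 1) (cong (_+ 1ℚ) (fromℕ-* 2 (p ℕ.^ suc m)))) ⟩
            fromℕ (2 ℕ.* p ℕ.^ suc m ℕ.+ 1)   ≤⟨ fromℕ-mono-≤ (2p^[1+m]+1≤p^[1+N] m N 2+m≤N) ⟩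
            p^ suc N                          ≡⟨ minus-plus (p^ suc N) ⟩
            D + 1ℚ                            ∎)

      1+n≤2^n : ∀ n → suc n ℕ.≤ 2 ℕ.^ n
      1+n≤2^n zero    = s≤s z≤n
      1+n≤2^n (suc n) = subst (ℕ._≤ 2 ℕ.^ n ℕ.+ (2 ℕ.^ n ℕ.+ 0)) (ℕ.+-comm (suc n) 1)
        (ℕ.+-mono-≤ (1+n≤2^n n) (ℕ.≤-trans (ℕ.m^n>0 2 n) (ℕ.m≤m+n _ 0)))

      [1+N]*selWeight≤selTail[1] : ∀ N → fromℕ (suc N) * selWeight p N ≤ selTail 1 N
      [1+N]*selWeight≤selTail[1] N = begin
        fromℕ (suc N) * selWeight p N   ≤⟨ *-monoʳ-≤-0≤ (selWeight p N) (0≤selWeight N) (fromℕ-mono-≤ 1+N≤p^N) ⟩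
        fromℕ ((p ℕ.^ 1) ℕ.^ N) * selWeight p N  ≡⟨ cong (_* selWeight p N) (sym (powℚ-fromℕ (p ℕ.^ 1) N)) ⟩
        powℚ (p^ 1) N * selWeight p N   ≡⟨ *-comm _ (selWeight p N) ⟩
        selTail 1 N                     ∎
        where
        open ≤-Reasoning
        1+N≤p^N : suc N ℕ.≤ (p ℕ.^ 1) ℕ.^ N
        1+N≤p^N = ℕ.≤-trans (1+n≤2^n N) (ℕ.^-monoˡ-≤ N (subst (2 ℕ.≤_) (sym (ℕ.*-identityʳ p)) 2≤p))

      selExpectPartial-cong : ∀ {f g : ℕ → ℚ} → (∀ d → f d ≡ g d) → ∀ N → selExpectPartial p f N ≡ selExpectPartial p g N
      selExpectPartial-cong f≡g N = cong (cPartial p N *_) (sum0-cong N (λ d → cong (selWeight p d *_) (f≡g d)))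

      moment-swap : ∀ m d → powℚ (p^ d) m ≡ powℚ (p^ m) d
      moment-swap m d = begin
        powℚ (p^ d) m             ≡⟨ powℚ-fromℕ (p ℕ.^ d) m ⟩
        fromℕ ((p ℕ.^ d) ℕ.^ m)   ≡⟨ cong fromℕ (trans (ℕ.^-*-assoc p d m) (trans (cong (p ℕ.^_) (ℕ.*-comm d m)) (sym (ℕ.^-*-assoc p m d)))) ⟩
        fromℕ ((p ℕ.^ m) ℕ.^ d)   ≡⟨ sym (powℚ-fromℕ (p ℕ.^ m) d) ⟩
        powℚ (p^ m) d             ∎
        where open ≡-Reasoning

      momentError : ℕ → ℕ → ℚ
      momentError m N = errorConst m * selTail m N + momentSel m * selTail 1 N + momentSel m * (fromℕ 2 * q^ N)

      momentError-null : ∀ m → Null (momentError m)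
      momentError-null m =
        Null-+ (Null-+ (Null-scale (errorConst m) (0≤errorConst m) (selTail-null m))
                       (Null-scale (momentSel m) (0≤momentSel m) (selTail-null 1)))
               (Null-scale (momentSel m) (0≤momentSel m) (Null-scale (fromℕ 2) (0≤fromℕ 2) q^-null))

      ∣cPartial*x∣≤ : ∀ N {x b} → ∣ x ∣ ≤ b → ∣ cPartial p N * x ∣ ≤ b
      ∣cPartial*x∣≤ N {x} {b} ∣x∣≤b = ≤-trans (∣c*x∣≤c*b (0≤cPartial N) ∣x∣≤b)
        (≤-trans (*-monoʳ-≤-0≤ b (≤-trans (0≤∣p∣ x) ∣x∣≤b) (cPartial≤1 N)) (≤-reflexive (*-identityˡ b)))

      selMoment-error : ∀ m N → ∣ cPartial p N * selPGF N (p^ m) - momentSel m ∣ ≤ momentError m N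
      selMoment-error m N = begin
        ∣ c * F - Π ∣                                                  ≡⟨ cong ∣_∣ (split c F Π F₁ F′) ⟩
        ∣ c * (F - Π * F₁) + Π * (c * F₁ - F′) + Π * (F′ - 1ℚ) ∣       ≤⟨ ∣x+y+z∣≤ (c * (F - Π * F₁)) (Π * (c * F₁ - F′)) (Π * (F′ - 1ℚ)) ⟩
        ∣ c * (F - Π * F₁) ∣ + ∣ Π * (c * F₁ - F′) ∣ + ∣ Π * (F′ - 1ℚ) ∣
          ≤⟨ +-mono-≤ (+-mono-≤ (∣cPartial*x∣≤ N (selPGF-p^-error m N))
                                (∣c*x∣≤c*b (0≤momentSel m) (≤-trans (cPartial*selPGF-1-error N) ([1+N]*selWeight≤selTail[1] N))))
                      (∣c*x∣≤c*b (0≤momentSel m) (∣selPGF[q^[1+N]]-1∣≤2q^N N)) ⟩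
        momentError m N                                                ∎
        where
        open ≤-Reasoning
        c : ℚ
        c = cPartial p N
        F : ℚ
        F = selPGF N (p^ m)
        Π : ℚ
        Π = momentSel m
        F₁ : ℚ
        F₁ = selPGF N 1ℚ
        F′ : ℚ
        F′ = selPGF N (q^ suc N)
        split : ∀ c F Π F₁ F′ → c * F - Π ≡ c * (F - Π * F₁) + Π * (c * F₁ - F′) + Π * (F′ - 1ℚ)
        split = solve-∀ ℚ-ring
        ∣x+y+z∣≤ : ∀ x y z → ∣ x + y + z ∣ ≤ ∣ x ∣ + ∣ y ∣ + ∣ z ∣
        ∣x+y+z∣≤ x y z = ≤-trans (∣p+q∣≤∣p∣+∣q∣ (x + y) z) (+-monoˡ-≤ ∣ z ∣ (∣p+q∣≤∣p∣+∣q∣ x y))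

      selExpect-moment≡ : ∀ m N → selExpectPartial p (λ d → powℚ (p^ d) m) N ≡ cPartial p N * selPGF N (p^ m)
      selExpect-moment≡ m = selExpectPartial-cong (moment-swap m)

      selExpect-parity-moment≡ : ∀ b m N → selExpectPartial p (λ d → hasParity b d * powℚ (p^ d) m) N
        ≡ ½ * (cPartial p N * selPGF N (p^ m)) + sign b * (cPartial p N * selPGF N (- p^ m))
      selExpect-parity-moment≡ b m N = begin
        c * sum0 N (λ d → selWeight p d * (hasParity b d * powℚ (p^ d) m))
          ≡⟨ cong (c *_) (sum0-cong N term) ⟩
        c * sum0 N (λ d → ½ * (selWeight p d * powℚ (p^ m) d) + sign b * (selWeight p d * powℚ (- p^ m) d))
          ≡⟨ cong (c *_) (sum0-linear N ½ (sign b) (λ d → selWeight p d * powℚ (p^ m) d) (λ d → selWeight p d * powℚ (- p^ m) d)) ⟩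
        c * (½ * selPGF N (p^ m) + sign b * selPGF N (- p^ m))
          ≡⟨ distrib c (sign b) (selPGF N (p^ m)) (selPGF N (- p^ m)) ⟩
        ½ * (c * selPGF N (p^ m)) + sign b * (c * selPGF N (- p^ m)) ∎
        where
        open ≡-Reasoning
        c : ℚ
        c = cPartial p N
        expand : ∀ u s σ F → u * ((½ + s * σ) * F) ≡ ½ * (u * F) + s * (u * (σ * F))
        expand = solve-∀ ℚ-ring
        distrib : ∀ c s X Y → c * (½ * X + s * Y) ≡ ½ * (c * X) + s * (c * Y)
        distrib = solve-∀ ℚ-ring
        term : ∀ d → selWeight p d * (hasParity b d * powℚ (p^ d) m)
                     ≡ ½ * (selWeight p d * powℚ (p^ m) d) + sign b * (selWeight p d * powℚ (- p^ m) d)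
        term d = begin
          selWeight p d * (hasParity b d * powℚ (p^ d) m)
            ≡⟨ cong₂ (λ x y → selWeight p d * (x * y)) (hasParity≡½+sign b d) (moment-swap m d) ⟩
          selWeight p d * ((½ + sign b * powℚ (- 1ℚ) d) * powℚ (p^ m) d)
            ≡⟨ expand (selWeight p d) (sign b) (powℚ (- 1ℚ) d) (powℚ (p^ m) d) ⟩
          ½ * (selWeight p d * powℚ (p^ m) d) + sign b * (selWeight p d * (powℚ (- 1ℚ) d * powℚ (p^ m) d))
            ≡⟨ cong (λ z → ½ * (selWeight p d * powℚ (p^ m) d) + sign b * (selWeight p d * z)) (sym (powℚ-neg (p^ m) d)) ⟩
          ½ * (selWeight p d * powℚ (p^ m) d) + sign b * (selWeight p d * powℚ (- p^ m) d) ∎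

      parityError : ℕ → ℕ → ℚ
      parityError m N = ½ * momentError m N + ½ * (errorConst m * selTail m N)

      parityError-null : ∀ m → Null (parityError m)
      parityError-null m = Null-+ (Null-scale ½ 0≤½ (momentError-null m))
                                  (Null-scale ½ 0≤½ (Null-scale (errorConst m) (0≤errorConst m) (selTail-null m)))

      selExpect-parity-moment-error : ∀ b m N →
        ∣ selExpectPartial p (λ d → hasParity b d * powℚ (p^ d) m) N - ½ * momentSel m ∣ ≤ parityError m N
      selExpect-parity-moment-error b m N = begin
        ∣ selExpectPartial p (λ d → hasParity b d * powℚ (p^ d) m) N - ½ * Π ∣
          ≡⟨ cong (λ z → ∣ z - ½ * Π ∣) (selExpect-parity-moment≡ b m N) ⟩
        ∣ ½ * X + sign b * Y - ½ * Π ∣                    ≡⟨ cong ∣_∣ (regroup X Y (sign b) Π) ⟩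
        ∣ ½ * (X - Π) + sign b * Y ∣                      ≤⟨ ∣p+q∣≤∣p∣+∣q∣ (½ * (X - Π)) (sign b * Y) ⟩
        ∣ ½ * (X - Π) ∣ + ∣ sign b * Y ∣
          ≡⟨ cong (λ z → ∣ ½ * (X - Π) ∣ + z) (trans (∣p*q∣≡∣p∣*∣q∣ (sign b) Y) (cong (_* ∣ Y ∣) (∣sign∣ b))) ⟩
        ∣ ½ * (X - Π) ∣ + ½ * ∣ Y ∣                       ≤⟨ +-mono-≤ (∣c*x∣≤c*b 0≤½ (selMoment-error m N))
                                                                      (*-monoˡ-≤-0≤ ½ 0≤½ (∣cPartial*x∣≤ N (selPGF-neg-p^-bound m N))) ⟩
        parityError m N                                   ∎
        where
        open ≤-Reasoning
        Π : ℚ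
        Π = momentSel m
        X : ℚ
        X = cPartial p N * selPGF N (p^ m)
        Y : ℚ
        Y = cPartial p N * selPGF N (- p^ m)
        regroup : ∀ X Y s Π → ½ * X + s * Y - ½ * Π ≡ ½ * (X - Π) + s * Y
        regroup = solve-∀ ℚ-ring

      selExpect-moment : ∀ m → ConvergesTo (selExpectPartial p (λ d → powℚ (p^ d) m)) (momentSel m)
      selExpect-moment m = converges-by-null {selExpectPartial p (λ d → powℚ (p^ d) m)} {momentSel m} (momentError-null m) 0 λ N _ →
        subst (λ z → ∣ z - momentSel m ∣ ≤ momentError m N) (sym (selExpect-moment≡ m N)) (selMoment-error m N)

      selExpect-p^ : ConvergesTo (selExpectPartial p p^_) (fromℕ p + 1ℚ)
      selExpect-p^ = ConvergesTo-cong (selExpectPartial-cong (λ d → *-identityʳ (p^ d)))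
        (trans (*-identityˡ _) (cong (λ z → fromℕ z + 1ℚ) (ℕ.*-identityʳ p))) (selExpect-moment 1)

      selExpect-parity-moment : ∀ b m → ConvergesTo (selExpectPartial p (λ d → hasParity b d * powℚ (p^ d) m)) (½ * momentSel m)
      selExpect-parity-moment b m = converges-by-null {selExpectPartial p (λ d → hasParity b d * powℚ (p^ d) m)} {½ * momentSel m}
        (parityError-null m) 0 (λ N _ → selExpect-parity-moment-error b m N)

      selExpect-parity : ∀ b → ConvergesTo (selExpectPartial p (hasParity b)) ½
      selExpect-parity b = ConvergesTo-cong (selExpectPartial-cong (λ d → *-identityʳ (hasParity b d))) (*-identityʳ ½)
        (selExpect-parity-moment b 0)

      selCondExpect-moment : ∀ b m → ConvergesTo (selCondExpectPartial p (λ d → powℚ (p^ d) m) b) (momentSel m)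
      selCondExpect-moment b m =
        ratio-converges {selExpectPartial p (λ d → hasParity b d * powℚ (p^ d) m)} {selExpectPartial p (hasParity b)}
          (parityError-null m) (parityError-null 0)
          (selExpect-parity-moment-error b m)
          (λ N → subst₂ (λ x y → ∣ x - y ∣ ≤ parityError 0 N)
                   (selExpectPartial-cong (λ d → *-identityʳ (hasParity b d)) N) (*-identityʳ ½)
                   (selExpect-parity-moment-error b 0 N))

open import Data.Bool using (Bool; true)
open import Data.Nat using (ℕ; NonZero; _^_; _≤_; _<_; nonTrivial⇒n>1)
open import Data.Nat.Primality using (Prime; prime⇒nonZero; prime⇒nonTrivial)
open import Data.Integer using (+_; -_; _-_)
open import Data.Rational using (ℚ; 1ℚ; ½; _+_; _*_)
open import Data.Product using (_×_; _,_)
open import Relation.Binary.PropositionalEquality using (_≡_)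

proposition2p22 :
    (p : ℕ) → Prime p → (m : ℕ) →
    -- (a) moments of p^{X_n}
    ((n : ℕ) → 1 ≤ n →
      expectXn p n (λ k → powℚ (fromℕ (p ^ k)) m)
        ≡ prod1 m (λ i → (fromℕ (p ^ i) + 1ℚ) * inv (1ℚ + zpow p (- (+ n - + i)))))
    -- (a) moments of p^{X_Sel}
    × ConvergesTo (selExpectPartial p (λ d → powℚ (fromℕ (p ^ d)) m))
                  (prod1 m (λ i → fromℕ (p ^ i) + 1ℚ))
    × ConvergesTo (selExpectPartial p (λ d → fromℕ (p ^ d))) (fromℕ p + 1ℚ)
    -- (b) parity probabilities
    × ((n : ℕ) → 1 ≤ n → expectXn p n (hasParity true) ≡ ½)
    × ConvergesTo (selExpectPartial p (hasParity true)) ½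
    -- (c) conditional moments given a prescribed parity b
    × ((b : Bool) →
        ConvergesTo (selCondExpectPartial p (λ d → powℚ (fromℕ (p ^ d)) m) b)
                    (prod1 m (λ i → fromℕ (p ^ i) + 1ℚ)))
    × ((n : ℕ) → m < n → (b : Bool) →
        condExpectXn p n (λ k → powℚ (fromℕ (p ^ k)) m) b
          ≡ prod1 m (λ i → (fromℕ (p ^ i) + 1ℚ) * inv (1ℚ + zpow p (- (+ n - + i)))))
proposition2p22 p p-prime m =
    (λ n _ → expectXn-moment p m n)
  , selExpect-moment p 2≤p m
  , selExpect-p^ p 2≤p
  , (λ n 0<n → expectXn-parity p true n 0<n)
  , selExpect-parity p 2≤p true
  , (λ b → selCondExpect-moment p 2≤p b m)
  , (λ n m<n b → condExpectXn-moment p b m n m<n)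
  where
  instance
    p≢0 : NonZero p
    p≢0 = prime⇒nonZero p-prime
  2≤p : 2 ≤ p
  2≤p = nonTrivial⇒n>1 p {{prime⇒nonTrivial p-prime}}
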